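{- Let $m=2^n$ with $n>2$, let $r\in\{1,2,\ldots,\frac m2-1\}$, and let $S=\{\frac m2-r,\frac m2-(r-1),\ldots,\frac m2-1,\frac m2\}$. If $G=C_m(S)$, then $|\det(A(G))|=2r+1$, where $A(G)$ is the adjacency matrix of $G$.
   Context: For $m\ge 4$ and $S\subseteq\{1,2,\ldots,\lfloor m/2\rfloor\}$, the circulant graph $C_m(S)$ has vertices $x_0,x_1,\ldots,x_{m-1}$, and distinct $x_i,x_j$ are adjacent if and only if $|i-j|\in\{s,\,m-s : s\in S\}$. -}

module Defs where

open import Data.Nat using (ℕ; zero; suc; _∸_; ∣_-_∣; _≟_)
open import Data.Fin using (Fin; zero; suc; toℕ; punchIn)
open import Data.Integer using (ℤ; +_; _+_; _*_; -_)
open import Data.List using (List; []; _∷_; map; upTo)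
open import Data.List.Relation.Unary.Any using (Any; any?)
open import Data.Sum using (_⊎_)
open import Data.Product using (_×_)
open import Relation.Nullary using (¬_; Dec; yes; no)
open import Relation.Nullary.Decidable using (_⊎-dec_; _×-dec_; ¬?)
open import Relation.Binary.PropositionalEquality using (_≡_)

Matrix : ℕ → Set
Matrix n = Fin n → Fin n → ℤ

sumFin : ∀ {n} → (Fin n → ℤ) → ℤ
sumFin {zero}  f = + 0
sumFin {suc n} f = f zero + sumFin (λ i → f (suc i))

sign : ℕ → ℤ
sign zero = + 1
sign (suc k) = - sign k

minor : ∀ {n} → Fin (suc n) → Matrix (suc n) → Matrix n
minor j M i k = M (suc i) (punchIn j k)

det : ∀ {n} → Matrix n → ℤ
det {zero}  M = + 1
det {suc n} M = sumFin (λ j → sign (toℕ j) * (M zero j * det (minor j M)))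

open Data.Integer using (∣_∣) public

CircAdj : (m : ℕ) → List ℕ → Fin m → Fin m → Set
CircAdj m S i j =
  ¬ (i ≡ j) × Any (λ s → (∣ toℕ i - toℕ j ∣ ≡ s) ⊎ (∣ toℕ i - toℕ j ∣ ≡ m ∸ s)) S

circAdj? : (m : ℕ) (S : List ℕ) (i j : Fin m) → Dec (CircAdj m S i j)
circAdj? m S i j =
  ¬? (i Data.Fin.≟ j) ×-dec
  any? (λ s → (∣ toℕ i - toℕ j ∣ ≟ s) ⊎-dec (∣ toℕ i - toℕ j ∣ ≟ m ∸ s)) S

adjacency : (m : ℕ) → List ℕ → Matrix m
adjacency m S i j with circAdj? m S i j
... | yes _ = + 1
... | no  _ = + 0

connSet : (m r : ℕ) → List ℕ
connSet m r = map (λ k → Data.Nat.⌊ m /2⌋ ∸ k) (upTo (suc r))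

{-# OPTIONS --safe #-}

-- With m = 2h and s = 2r + 1, row i of the adjacency matrix has its ones exactly in the s
-- cyclically consecutive columns i + h − r, …, i + h + r. Subtracting from every row but the
-- first the row above it leaves e_{i+h+r} − e_{i+h−r−1}. As s is odd it generates ℤ/2ⁿ, so
-- taking these rows in the order s, 2s, 3s, … walks along a single cycle through all columns;
-- prefix sums along the cycle turn them into e_c − e_{c₀}, after which the remaining row of s
-- consecutive ones reduces to s·e_{c₀}. The result is triangular up to a permutation of the
-- columns, with diagonal 1, …, 1, s.

module Submission where

open import Defs
open import Data.Nat using (ℕ; zero; suc; _≤_; _<_; z≤n; s≤s; s≤s⁻¹; s<s⁻¹)
import Data.Nat as ℕ
import Data.Nat.Properties as ℕ
open import Data.Nat.Coprimality using (Coprime)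
open import Data.Fin using (Fin; zero; suc; toℕ; punchIn; punchOut)
import Data.Fin as Fin
import Data.Fin.Properties as Fin
open import Data.Fin.Permutation.Components using (transpose; transpose-inverse)
open import Data.Vec.Functional using (updateAt)
open import Data.Vec.Functional.Properties
  using (updateAt-updates; updateAt-minimal; updateAt-id-local; map-updateAt-local)
open import Data.Product using (Σ; _×_; _,_; proj₁; proj₂)
open import Data.Unit using (⊤; tt)
open import Data.Empty using (⊥-elim)
open import Function using (_∘_; const)
open import Function.Definitions using (Injective)
open import Relation.Nullary using (¬_; Dec; yes; no)
open import Relation.Nullary.Decidable using (dec-true; dec-false)
open import Relation.Binary.PropositionalEquality
open import Data.Integer.Properties using (*-1-commutativeMonoid)
open import Algebra.Properties.CommutativeMonoid.Sum *-1-commutativeMonoid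
  using () renaming (sum to product; sum-cong-≗ to product-cong; sum-remove to product-remove;
                     sum-replicate-zero to product-replicate-one)

module Determinant where

  open import Data.Integer using (ℤ; -_; _+_; _*_; 0ℤ; 1ℤ; -1ℤ)
  open import Data.Integer.Properties
  open import Data.Integer.Tactic.RingSolver using (solve-∀)
  open import Algebra.Properties.Semiring.Sum +-*-semiring
    using (sum; sum-cong-≗; sum-remove; ∑-distrib-+; *-distribˡ-sum; sum-replicate-zero)

  sumFin≡sum : ∀ {n} (f : Fin n → ℤ) → sumFin f ≡ sum f
  sumFin≡sum {zero}  f = refl
  sumFin≡sum {suc n} f = cong (f zero +_) (sumFin≡sum (f ∘ suc))

  sumFin-cong : ∀ {n} {f g : Fin n → ℤ} → (∀ i → f i ≡ g i) → sumFin f ≡ sumFin g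
  sumFin-cong {f = f} {g} f≗g rewrite sumFin≡sum f | sumFin≡sum g = sum-cong-≗ f≗g

  sumFin-zero : ∀ {n} {f : Fin n → ℤ} → (∀ i → f i ≡ 0ℤ) → sumFin f ≡ 0ℤ
  sumFin-zero {n} f≗0 = trans (sumFin-cong f≗0) (trans (sumFin≡sum {n} (const 0ℤ)) (sum-replicate-zero n))

  sumFin-linear : ∀ {n} a b (f g : Fin n → ℤ) →
    sumFin (λ i → a * f i + b * g i) ≡ a * sumFin f + b * sumFin g
  sumFin-linear a b f g
    rewrite sumFin≡sum (λ i → a * f i + b * g i) | sumFin≡sum f | sumFin≡sum g
          | *-distribˡ-sum a f | *-distribˡ-sum b g = ∑-distrib-+ (λ i → a * f i) (λ i → b * g i)

  *-distribˡ-sumFin : ∀ {n} c (f : Fin n → ℤ) → c * sumFin f ≡ sumFin (λ i → c * f i)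
  *-distribˡ-sumFin c f rewrite sumFin≡sum f | sumFin≡sum (λ i → c * f i) = *-distribˡ-sum c f

  sumFin-neg : ∀ {n} (f : Fin n → ℤ) → sumFin (λ i → - f i) ≡ - sumFin f
  sumFin-neg f = begin
    sumFin (λ i → - f i)          ≡⟨ sumFin-cong (λ i → -1*i≡-i (f i)) ⟨
    sumFin (λ i → -1ℤ * f i)      ≡⟨ *-distribˡ-sumFin -1ℤ f ⟨
    -1ℤ * sumFin f                ≡⟨ -1*i≡-i (sumFin f) ⟩
    - sumFin f                    ∎
    where open ≡-Reasoning

  sumFin-remove : ∀ {n} (i : Fin (suc n)) (f : Fin (suc n) → ℤ) → sumFin f ≡ f i + sumFin (f ∘ punchIn i)
  sumFin-remove i f rewrite sumFin≡sum f | sumFin≡sum (f ∘ punchIn i) = sum-remove f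

  sumFin-single : ∀ {n} (i : Fin n) (f : Fin n → ℤ) → (∀ j → j ≢ i → f j ≡ 0ℤ) → sumFin f ≡ f i
  sumFin-single {suc n} i f vanish = begin
    sumFin f                          ≡⟨ sumFin-remove i f ⟩
    f i + sumFin (f ∘ punchIn i)      ≡⟨ cong (f i +_) (sumFin-zero (λ k → vanish _ (Fin.punchInᵢ≢i i k))) ⟩
    f i + 0ℤ                          ≡⟨ +-identityʳ (f i) ⟩
    f i                               ∎
    where open ≡-Reasoning

  module _ {n} {π : Fin (suc n) → Fin (suc n)} (π-injective : Injective _≡_ _≡_ π) where

    π₀≢π∘suc : ∀ i → π zero ≢ π (suc i)
    π₀≢π∘suc i eq = Fin.0≢1+n (π-injective eq)

    remove₀ : Fin n → Fin n
    remove₀ i = punchOut (π₀≢π∘suc i)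

    punchIn-remove₀ : ∀ i → punchIn (π zero) (remove₀ i) ≡ π (suc i)
    punchIn-remove₀ i = Fin.punchIn-punchOut (π₀≢π∘suc i)

    remove₀-injective : Injective _≡_ _≡_ remove₀
    remove₀-injective eq =
      Fin.suc-injective (π-injective (Fin.punchOut-injective (π₀≢π∘suc _) (π₀≢π∘suc _) eq))

  sumFin-reindex : ∀ {n} {σ : Fin n → Fin n} → Injective _≡_ _≡_ σ → (f : Fin n → ℤ) →
    sumFin (f ∘ σ) ≡ sumFin f
  sumFin-reindex {zero}          σ-inj f = refl
  sumFin-reindex {suc n} {σ = σ} σ-inj f = begin
    f (σ zero) + sumFin (f ∘ σ ∘ suc)
      ≡⟨ cong (f (σ zero) +_) (sumFin-cong (λ i → cong f (sym (punchIn-remove₀ σ-inj i)))) ⟩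
    f (σ zero) + sumFin (f ∘ punchIn (σ zero) ∘ remove₀ σ-inj)
      ≡⟨ cong (f (σ zero) +_) (sumFin-reindex (remove₀-injective σ-inj) (f ∘ punchIn (σ zero))) ⟩
    f (σ zero) + sumFin (f ∘ punchIn (σ zero))
      ≡⟨ sumFin-remove (σ zero) f ⟨
    sumFin f ∎
    where open ≡-Reasoning

  *-zeroʳ² : ∀ s a → s * (a * 0ℤ) ≡ 0ℤ
  *-zeroʳ² s a = trans (cong (s *_) (*-zeroʳ a)) (*-zeroʳ s)

  det-cong : ∀ {n} {M N : Matrix n} → (∀ i j → M i j ≡ N i j) → det M ≡ det N
  det-cong {zero}  M≗N = refl
  det-cong {suc n} M≗N = sumFin-cong λ j →
    cong₂ (λ a d → sign (toℕ j) * (a * d)) (M≗N zero j) (det-cong (λ i k → M≗N (suc i) (punchIn j k)))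

  infixl 5 _[_]≔_
  _[_]≔_ : ∀ {n} {A : Set} → (Fin n → A) → Fin n → A → (Fin n → A)
  xs [ p ]≔ x = updateAt xs p (const x)

  []≔-cong : ∀ {n k} (M : Fin n → Fin k → ℤ) p {x y : Fin k → ℤ} → (∀ j → x j ≡ y j) →
    ∀ i j → (M [ p ]≔ x) i j ≡ (M [ p ]≔ y) i j
  []≔-cong M zero    x≗y zero    j = x≗y j
  []≔-cong M zero    x≗y (suc i) j = refl
  []≔-cong M (suc p) x≗y zero    j = refl
  []≔-cong M (suc p) x≗y (suc i) j = []≔-cong (M ∘ suc) p x≗y i j

  []≔-updates : ∀ {n k} (M : Fin n → Fin k → ℤ) p x j → (M [ p ]≔ x) p j ≡ x j
  []≔-updates M p x j = cong-app (updateAt-updates p M) j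

  []≔-minimal : ∀ {n k} (M : Fin n → Fin k → ℤ) {p i} x → i ≢ p → ∀ j → (M [ p ]≔ x) i j ≡ M i j
  []≔-minimal M x i≢p j = cong-app (updateAt-minimal _ _ M i≢p) j

  []≔-self : ∀ {n} (M : Matrix n) p i j → (M [ p ]≔ M p) i j ≡ M i j
  []≔-self M p i j = cong-app (updateAt-id-local p M refl i) j

  minor-[suc]≔ : ∀ {n} (j : Fin (suc n)) (M : Matrix (suc n)) p x i k →
    minor j (M [ suc p ]≔ x) i k ≡ (minor j M [ p ]≔ (x ∘ punchIn j)) i k
  minor-[suc]≔ {n} j M p x i k =
    cong-app (map-updateAt-local {f = λ (row : Fin (suc n) → ℤ) → row ∘ punchIn j} (M ∘ suc) p refl i) k

  det-[]≔-cong : ∀ {n} (M : Matrix n) p {x y : Fin n → ℤ} → (∀ j → x j ≡ y j) →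
    det (M [ p ]≔ x) ≡ det (M [ p ]≔ y)
  det-[]≔-cong M p x≗y = det-cong ([]≔-cong M p x≗y)

  det-[]≔-self : ∀ {n} (M : Matrix n) p → det (M [ p ]≔ M p) ≡ det M
  det-[]≔-self M p = det-cong ([]≔-self M p)

  det-linear : ∀ {n} (M : Matrix n) p a b (u v : Fin n → ℤ) →
    det (M [ p ]≔ (λ j → a * u j + b * v j)) ≡ a * det (M [ p ]≔ u) + b * det (M [ p ]≔ v)
  det-linear {suc n} M zero a b u v =
    trans (sumFin-cong (λ j → distrib a b (sign (toℕ j)) (u j) (v j) (det (minor j M))))
          (sumFin-linear a b (λ j → sign (toℕ j) * (u j * det (minor j M)))
                             (λ j → sign (toℕ j) * (v j * det (minor j M))))
    where
    distrib : ∀ a b s x y d → s * ((a * x + b * y) * d) ≡ a * (s * (x * d)) + b * (s * (y * d))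
    distrib = solve-∀
  det-linear {suc n} M (suc p) a b u v = begin
    det (M [ suc p ]≔ w)
      ≡⟨ expand w ⟩
    sumFin (λ j → sign (toℕ j) * (M zero j * det (minor j M [ p ]≔ (w ∘ punchIn j))))
      ≡⟨ sumFin-cong (λ j → trans (cong (λ d → sign (toℕ j) * (M zero j * d))
                                        (det-linear (minor j M) p a b (u ∘ punchIn j) (v ∘ punchIn j)))
                                  (distrib a b (sign (toℕ j)) (M zero j) _ _)) ⟩
    sumFin (λ j → a * U j + b * V j)
      ≡⟨ sumFin-linear a b U V ⟩
    a * sumFin U + b * sumFin V
      ≡⟨ cong₂ (λ x y → a * x + b * y) (expand u) (expand v) ⟨
    a * det (M [ suc p ]≔ u) + b * det (M [ suc p ]≔ v) ∎
    where
    open ≡-Reasoning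
    w = λ j → a * u j + b * v j
    U = λ j → sign (toℕ j) * (M zero j * det (minor j M [ p ]≔ (u ∘ punchIn j)))
    V = λ j → sign (toℕ j) * (M zero j * det (minor j M [ p ]≔ (v ∘ punchIn j)))
    expand : ∀ x → det (M [ suc p ]≔ x) ≡
             sumFin (λ j → sign (toℕ j) * (M zero j * det (minor j M [ p ]≔ (x ∘ punchIn j))))
    expand x = sumFin-cong λ j →
      cong (λ d → sign (toℕ j) * (M zero j * d)) (det-cong (minor-[suc]≔ j M p x))
    distrib : ∀ a b s m x y → s * (m * (a * x + b * y)) ≡ a * (s * (m * x)) + b * (s * (m * y))
    distrib = solve-∀

  det-scaleRow : ∀ {n} (M : Matrix n) p a → det (M [ p ]≔ (λ j → a * M p j)) ≡ a * det M
  det-scaleRow M p a = begin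
    det (M [ p ]≔ (λ j → a * M p j))
      ≡⟨ det-[]≔-cong M p (λ j → pad (a * M p j) (M p j)) ⟩
    det (M [ p ]≔ (λ j → a * M p j + 0ℤ * M p j))
      ≡⟨ det-linear M p a 0ℤ (M p) (M p) ⟩
    a * det (M [ p ]≔ M p) + 0ℤ * det (M [ p ]≔ M p)
      ≡⟨ cong (λ d → a * d + 0ℤ * d) (det-[]≔-self M p) ⟩
    a * det M + 0ℤ * det M
      ≡⟨ pad (a * det M) (det M) ⟨
    a * det M ∎
    where
    open ≡-Reasoning
    pad : ∀ x y → x ≡ x + 0ℤ * y
    pad = solve-∀

  det-zeroRow : ∀ {n} (M : Matrix n) p → det (M [ p ]≔ const 0ℤ) ≡ 0ℤ
  det-zeroRow M p = begin
    det (M [ p ]≔ const 0ℤ)                ≡⟨ det-[]≔-cong M p (λ j → sym (*-zeroˡ (M p j))) ⟩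
    det (M [ p ]≔ (λ j → 0ℤ * M p j))      ≡⟨ det-scaleRow M p 0ℤ ⟩
    0ℤ * det M                             ≡⟨ *-zeroˡ (det M) ⟩
    0ℤ                                     ∎
    where open ≡-Reasoning

  det-linear-sum : ∀ {n k} (M : Matrix n) p (c : Fin k → ℤ) (y : Fin k → Fin n → ℤ) →
    det (M [ p ]≔ (λ j → sumFin (λ l → c l * y l j))) ≡ sumFin (λ l → c l * det (M [ p ]≔ y l))
  det-linear-sum {k = zero}  M p c y = det-zeroRow M p
  det-linear-sum {k = suc k} M p c y = begin
    det (M [ p ]≔ (λ j → c zero * y zero j + rest j))
      ≡⟨ det-[]≔-cong M p (λ j → cong (c zero * y zero j +_) (sym (*-identityˡ (rest j)))) ⟩
    det (M [ p ]≔ (λ j → c zero * y zero j + 1ℤ * rest j))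
      ≡⟨ det-linear M p (c zero) 1ℤ (y zero) rest ⟩
    c zero * det (M [ p ]≔ y zero) + 1ℤ * det (M [ p ]≔ rest)
      ≡⟨ cong (c zero * det (M [ p ]≔ y zero) +_)
              (trans (*-identityˡ _) (det-linear-sum M p (c ∘ suc) (y ∘ suc))) ⟩
    c zero * det (M [ p ]≔ y zero) + sumFin (λ l → c (suc l) * det (M [ p ]≔ y (suc l))) ∎
    where
    open ≡-Reasoning
    rest = λ j → sumFin (λ l → c (suc l) * y (suc l) j)

  det-addRowTo : ∀ {n} (M : Matrix n) p q c → det (M [ p ]≔ M q) ≡ 0ℤ →
    det (M [ p ]≔ (λ j → M p j + c * M q j)) ≡ det M
  det-addRowTo M p q c equalRows = begin
    det (M [ p ]≔ (λ j → M p j + c * M q j))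
      ≡⟨ det-[]≔-cong M p (λ j → cong (_+ c * M q j) (sym (*-identityˡ (M p j)))) ⟩
    det (M [ p ]≔ (λ j → 1ℤ * M p j + c * M q j))
      ≡⟨ det-linear M p 1ℤ c (M p) (M q) ⟩
    1ℤ * det (M [ p ]≔ M p) + c * det (M [ p ]≔ M q)
      ≡⟨ cong₂ (λ d e → 1ℤ * d + c * e) (det-[]≔-self M p) equalRows ⟩
    1ℤ * det M + c * 0ℤ
      ≡⟨ cong₂ _+_ (*-identityˡ (det M)) (*-zeroʳ c) ⟩
    det M + 0ℤ
      ≡⟨ +-identityʳ (det M) ⟩
    det M ∎
    where open ≡-Reasoning

  -- G j k is attached to the pair of columns {j, punchIn j k}; PairSymmetric G says it
  -- depends only on the unordered pair.
  PairSymmetric : ∀ {N} → (Fin (suc N) → Fin N → ℤ) → Set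
  PairSymmetric {zero}  G = ⊤
  PairSymmetric {suc N} G =
    (∀ k → G zero k ≡ G (suc k) zero) × PairSymmetric (λ j k → G (suc j) (suc k))

  doubleExpansion : ∀ {N} → (Fin (suc N) → ℤ) → (Fin (suc N) → Fin N → ℤ) → ℤ
  doubleExpansion a G =
    sumFin (λ j → sign (toℕ j) * (a j * sumFin (λ k → sign (toℕ k) * (a (punchIn j k) * G j k))))

  -- The terms with j = 0 cancel the terms with k = 0 by symmetry; the rest is the same sum
  -- one size down.
  doubleExpansion-pairSymmetric : ∀ {N} a G → PairSymmetric {N} G → doubleExpansion a G ≡ 0ℤ
  doubleExpansion-pairSymmetric {zero} a G _ =
    trans (+-identityʳ _) (trans (*-identityˡ _) (*-zeroʳ (a zero)))
  doubleExpansion-pairSymmetric {suc N} a G (G₀ₖ≡Gₖ₀ , symmetric) = begin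
    1ℤ * (a zero * sumFin X) + sumFin T
      ≡⟨ cong (1ℤ * (a zero * sumFin X) +_) (sumFin-cong split) ⟩
    1ℤ * (a zero * sumFin X) + sumFin (λ j → (- a zero) * X′ j + 1ℤ * Y j)
      ≡⟨ cong (1ℤ * (a zero * sumFin X) +_) (sumFin-linear (- a zero) 1ℤ X′ Y) ⟩
    1ℤ * (a zero * sumFin X) + ((- a zero) * sumFin X′ + 1ℤ * doubleExpansion (a ∘ suc) G′)
      ≡⟨ cong₂ (λ x y → 1ℤ * (a zero * sumFin X) + ((- a zero) * x + 1ℤ * y))
               (sym (sumFin-cong (λ k → cong (λ g → sign (toℕ k) * (a (suc k) * g)) (G₀ₖ≡Gₖ₀ k))))
               (doubleExpansion-pairSymmetric (a ∘ suc) G′ symmetric) ⟩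
    1ℤ * (a zero * sumFin X) + ((- a zero) * sumFin X + 1ℤ * 0ℤ)
      ≡⟨ cancel (a zero) (sumFin X) ⟩
    0ℤ ∎
    where
    open ≡-Reasoning
    G′ = λ j k → G (suc j) (suc k)
    X  = λ k → sign (toℕ k) * (a (suc k) * G zero k)
    X′ = λ j → sign (toℕ j) * (a (suc j) * G (suc j) zero)
    Z  = λ j → sumFin (λ k → sign (toℕ k) * (a (suc (punchIn j k)) * G′ j k))
    Y  = λ j → sign (toℕ j) * (a (suc j) * Z j)
    T  = λ j → - sign (toℕ j) * (a (suc j) * (1ℤ * (a zero * G (suc j) zero)
                 + sumFin (λ k → - sign (toℕ k) * (a (suc (punchIn j k)) * G′ j k))))
    regroup : ∀ s b a₀ g z → - s * (b * (1ℤ * (a₀ * g) + - z)) ≡ (- a₀) * (s * (b * g)) + 1ℤ * (s * (b * z))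
    regroup = solve-∀
    split : ∀ j → T j ≡ (- a zero) * X′ j + 1ℤ * Y j
    split j = trans
      (cong (λ z → - sign (toℕ j) * (a (suc j) * (1ℤ * (a zero * G (suc j) zero) + z)))
            (trans (sumFin-cong (λ k → sym (neg-distribˡ-* (sign (toℕ k)) (a (suc (punchIn j k)) * G′ j k))))
                   (sumFin-neg (λ k → sign (toℕ k) * (a (suc (punchIn j k)) * G′ j k)))))
      (regroup (sign (toℕ j)) (a (suc j)) (a zero) (G (suc j) zero) (Z j))
    cancel : ∀ a₀ x → 1ℤ * (a₀ * x) + ((- a₀) * x + 1ℤ * 0ℤ) ≡ 0ℤ
    cancel = solve-∀

  PairSymmetric-cong : ∀ {N} {G H : Fin (suc N) → Fin N → ℤ} →
    (∀ j k → G j k ≡ H j k) → PairSymmetric G → PairSymmetric H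
  PairSymmetric-cong {zero}  G≗H _ = tt
  PairSymmetric-cong {suc N} G≗H (G₀ₖ≡Gₖ₀ , symmetric) =
    (λ k → trans (sym (G≗H zero k)) (trans (G₀ₖ≡Gₖ₀ k) (G≗H (suc k) zero))) ,
    PairSymmetric-cong (λ j k → G≗H (suc j) (suc k)) symmetric

  punchIn²-pairSymmetric : ∀ {N} (g : (Fin N → Fin (suc (suc N))) → ℤ) →
    (∀ {φ ψ} → (∀ c → φ c ≡ ψ c) → g φ ≡ g ψ) →
    PairSymmetric (λ j k → g (punchIn j ∘ punchIn k))
  punchIn²-pairSymmetric {zero}  g g-cong = (λ k → g-cong (λ ())) , tt
  punchIn²-pairSymmetric {suc N} g g-cong = (λ k → g-cong (λ c → refl)) ,
    PairSymmetric-cong (λ j k → g-cong (lift-punchIn² j k))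
      (punchIn²-pairSymmetric (g ∘ lift₀) (λ φ≗ψ → g-cong (lift₀-cong φ≗ψ)))
    where
    lift₀ : (Fin N → Fin (suc (suc N))) → Fin (suc N) → Fin (suc (suc (suc N)))
    lift₀ = Fin.lift 1
    lift-punchIn² : ∀ j k c → lift₀ (punchIn j ∘ punchIn k) c ≡ punchIn (suc j) (punchIn (suc k) c)
    lift-punchIn² j k zero    = refl
    lift-punchIn² j k (suc c) = refl
    lift₀-cong : ∀ {φ ψ} → (∀ c → φ c ≡ ψ c) → ∀ c → lift₀ φ c ≡ lift₀ ψ c
    lift₀-cong φ≗ψ zero    = refl
    lift₀-cong φ≗ψ (suc c) = cong suc (φ≗ψ c)

  det-equalRows₀₁ : ∀ {n} (M : Matrix (suc (suc n))) → (∀ j → M zero j ≡ M (suc zero) j) → det M ≡ 0ℤ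
  det-equalRows₀₁ M row₀≡row₁ =
    trans (sumFin-cong λ j → cong (λ d → sign (toℕ j) * (M zero j * d)) (sumFin-cong λ k →
             cong (λ x → sign (toℕ k) * (x * det (minor k (minor j M)))) (sym (row₀≡row₁ (punchIn j k)))))
          (doubleExpansion-pairSymmetric (M zero) (λ j k → det (minor k (minor j M)))
             (punchIn²-pairSymmetric (λ φ → det (λ i c → M (suc (suc i)) (φ c)))
                                     (λ φ≗ψ → det-cong (λ i c → cong (M (suc (suc i))) (φ≗ψ c)))))

  -- Three row additions, each allowed because it only needs equal rows {0,1} or rows ≥ 1,
  -- move the copy of row 0 from row q+2 to row 1.
  det-equalRows₀ : ∀ {n} (M : Matrix (suc (suc n))) (q : Fin n) →
    (∀ (N : Matrix (suc (suc n))) {p q} → p ≢ q → (∀ j → N (suc p) j ≡ N (suc q) j) → det N ≡ 0ℤ) →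
    (∀ j → M zero j ≡ M (suc (suc q)) j) → det M ≡ 0ℤ
  det-equalRows₀ M q equalRows-suc row₀≡rowQ = begin
    det M    ≡⟨ det-addRowTo M one zero 1ℤ (det-equalRows₀₁ (M [ one ]≔ M zero) (λ j → refl)) ⟨
    det M₁   ≡⟨ det-addRowTo M₁ Q one -1ℤ (equalRows-suc (M₁ [ Q ]≔ M₁ one) {suc q} {zero} (λ ())
                                            ([]≔-updates M₁ Q (M₁ one))) ⟨
    det M₂   ≡⟨ det-addRowTo M₂ one Q 1ℤ (equalRows-suc (M₂ [ one ]≔ M₂ Q) {zero} {suc q} (λ ())
                                            (λ j → refl)) ⟨
    det M₃   ≡⟨ det-equalRows₀₁ M₃ (λ j → sym (row₁≡row₀ j)) ⟩
    0ℤ       ∎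
    where
    open ≡-Reasoning
    one = suc zero
    Q   = suc (suc q)
    M₁ = M  [ one ]≔ (λ j → M  one j + 1ℤ  * M  zero j)
    M₂ = M₁ [ Q   ]≔ (λ j → M₁ Q   j + -1ℤ * M₁ one j)
    M₃ = M₂ [ one ]≔ (λ j → M₂ one j + 1ℤ  * M₂ Q j)
    telescope : ∀ r₀ r₁ → (r₁ + 1ℤ * r₀) + 1ℤ * (r₀ + -1ℤ * (r₁ + 1ℤ * r₀)) ≡ r₀
    telescope = solve-∀
    row₁≡row₀ : ∀ j → M₃ one j ≡ M zero j
    row₁≡row₀ j = begin
      M₁ one j + 1ℤ * M₂ Q j
        ≡⟨ cong (λ r → M₁ one j + 1ℤ * r) ([]≔-updates M₁ Q _ j) ⟩
      (M one j + 1ℤ * M zero j) + 1ℤ * (M Q j + -1ℤ * (M one j + 1ℤ * M zero j))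
        ≡⟨ cong (λ r → (M one j + 1ℤ * M zero j) + 1ℤ * (r + -1ℤ * (M one j + 1ℤ * M zero j))) (row₀≡rowQ j) ⟨
      (M one j + 1ℤ * M zero j) + 1ℤ * (M zero j + -1ℤ * (M one j + 1ℤ * M zero j))
        ≡⟨ telescope (M zero j) (M one j) ⟩
      M zero j ∎

  mutual
    det-equalRows : ∀ {n} (M : Matrix n) {p q} → p ≢ q → (∀ j → M p j ≡ M q j) → det M ≡ 0ℤ
    det-equalRows M {zero}        {zero}        p≢q _  = ⊥-elim (p≢q refl)
    det-equalRows M {zero}        {suc zero}    _   eq = det-equalRows₀₁ M eq
    det-equalRows M {suc zero}    {zero}        _   eq = det-equalRows₀₁ M (sym ∘ eq)
    det-equalRows M {zero}        {suc (suc q)} _   eq = det-equalRows₀ M q det-equalRows-suc eq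
    det-equalRows M {suc (suc p)} {zero}        _   eq = det-equalRows₀ M p det-equalRows-suc (sym ∘ eq)
    det-equalRows M {suc p}       {suc q}       p≢q eq = det-equalRows-suc M (p≢q ∘ cong suc) eq

    det-equalRows-suc : ∀ {n} (M : Matrix (suc n)) {p q} → p ≢ q →
      (∀ j → M (suc p) j ≡ M (suc q) j) → det M ≡ 0ℤ
    det-equalRows-suc M p≢q eq = sumFin-zero λ j →
      trans (cong (λ d → sign (toℕ j) * (M zero j * d)) (det-equalRows (minor j M) p≢q (eq ∘ punchIn j)))
            (*-zeroʳ² (sign (toℕ j)) (M zero j))

  det-[]≔-copy : ∀ {n} (M : Matrix n) {p q} → p ≢ q → det (M [ p ]≔ M q) ≡ 0ℤ
  det-[]≔-copy M {p} {q} p≢q = det-equalRows (M [ p ]≔ M q) p≢q λ j →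
    trans ([]≔-updates M p (M q) j) (sym ([]≔-minimal M (M q) (p≢q ∘ sym) j))

  det-addCombinationTo : ∀ {n} (M : Matrix n) p (c : Fin n → ℤ) → c p ≡ 0ℤ →
    det (M [ p ]≔ (λ j → M p j + sumFin (λ l → c l * M l j))) ≡ det M
  det-addCombinationTo M p c cₚ≡0 = begin
    det (M [ p ]≔ (λ j → M p j + combination j))
      ≡⟨ det-[]≔-cong M p (λ j → sym (cong₂ _+_ (*-identityˡ (M p j)) (*-identityˡ (combination j)))) ⟩
    det (M [ p ]≔ (λ j → 1ℤ * M p j + 1ℤ * combination j))
      ≡⟨ det-linear M p 1ℤ 1ℤ (M p) combination ⟩
    1ℤ * det (M [ p ]≔ M p) + 1ℤ * det (M [ p ]≔ combination)
      ≡⟨ cong₂ (λ d e → 1ℤ * d + 1ℤ * e) (det-[]≔-self M p)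
               (trans (det-linear-sum M p c M) (sumFin-zero vanish)) ⟩
    1ℤ * det M + 1ℤ * 0ℤ
      ≡⟨ trans (cong₂ _+_ (*-identityˡ (det M)) refl) (+-identityʳ (det M)) ⟩
    det M ∎
    where
    open ≡-Reasoning
    combination = λ j → sumFin (λ l → c l * M l j)
    vanish : ∀ l → c l * det (M [ p ]≔ M l) ≡ 0ℤ
    vanish l with l Fin.≟ p
    ... | yes refl = trans (cong (_* det (M [ p ]≔ M p)) cₚ≡0) (*-zeroˡ (det (M [ p ]≔ M p)))
    ... | no l≢p   = trans (cong (c l *_) (det-[]≔-copy M (l≢p ∘ sym))) (*-zeroʳ (c l))

  transpose-matchˡ : ∀ {n} (i j : Fin n) → transpose i j i ≡ j
  transpose-matchˡ i j rewrite dec-true (i Fin.≟ i) refl = refl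

  transpose-matchʳ : ∀ {n} (i j : Fin n) → transpose i j j ≡ i
  transpose-matchʳ i j with j Fin.≟ i
  ... | yes refl = refl
  ... | no  _    rewrite dec-true (j Fin.≟ j) refl = refl

  transpose-mismatch : ∀ {n} (i j k : Fin n) → k ≢ i → k ≢ j → transpose i j k ≡ k
  transpose-mismatch i j k k≢i k≢j rewrite dec-false (k Fin.≟ i) k≢i | dec-false (k Fin.≟ j) k≢j = refl

  transpose-self : ∀ {n} (i k : Fin n) → transpose i i k ≡ k
  transpose-self i k with k Fin.≟ i
  ... | yes refl = refl
  ... | no  k≢i  rewrite dec-false (k Fin.≟ i) k≢i = refl

  det-swapRows : ∀ {n} (M : Matrix n) {p q} → p ≢ q → det (M ∘ transpose p q) ≡ - det M
  det-swapRows M {p} {q} p≢q = begin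
    det (M ∘ transpose p q) ≡⟨ det-cong swapped ⟩
    det R                   ≡⟨ det-scaleRow M₃ q -1ℤ ⟩
    -1ℤ * det M₃            ≡⟨ -1*i≡-i (det M₃) ⟩
    - det M₃                ≡⟨ cong -_ (det-addRowTo M₂ p q 1ℤ (det-[]≔-copy M₂ p≢q)) ⟩
    - det M₂                ≡⟨ cong -_ (det-addRowTo M₁ q p -1ℤ (det-[]≔-copy M₁ q≢p)) ⟩
    - det M₁                ≡⟨ cong -_ (det-addRowTo M p q 1ℤ (det-[]≔-copy M p≢q)) ⟩
    - det M                 ∎
    where
    open ≡-Reasoning
    q≢p = p≢q ∘ sym
    M₁ = M  [ p ]≔ (λ j → M  p j + 1ℤ  * M  q j)
    M₂ = M₁ [ q ]≔ (λ j → M₁ q j + -1ℤ * M₁ p j)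
    M₃ = M₂ [ p ]≔ (λ j → M₂ p j + 1ℤ  * M₂ q j)
    R  = M₃ [ q ]≔ (λ j → -1ℤ * M₃ q j)
    Rp≡Mq : ∀ j → R p j ≡ M q j
    Rp≡Mq j = begin
      R p j                                   ≡⟨ []≔-minimal M₃ _ p≢q j ⟩
      M₃ p j                                  ≡⟨ []≔-updates M₂ p _ j ⟩
      M₂ p j + 1ℤ * M₂ q j                    ≡⟨ cong₂ (λ a b → a + 1ℤ * b) ([]≔-minimal M₁ _ p≢q j)
                                                        ([]≔-updates M₁ q _ j) ⟩
      M₁ p j + 1ℤ * (M₁ q j + -1ℤ * M₁ p j)   ≡⟨ cong₂ (λ a b → a + 1ℤ * (b + -1ℤ * a))
                                                        ([]≔-updates M p _ j) ([]≔-minimal M _ q≢p j) ⟩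
      (u + 1ℤ * v) + 1ℤ * (v + -1ℤ * (u + 1ℤ * v)) ≡⟨ solve₁ u v ⟩
      v ∎
      where u = M p j; v = M q j
            solve₁ : ∀ u v → (u + 1ℤ * v) + 1ℤ * (v + -1ℤ * (u + 1ℤ * v)) ≡ v
            solve₁ = solve-∀
    Rq≡Mp : ∀ j → R q j ≡ M p j
    Rq≡Mp j = begin
      R q j                                   ≡⟨ []≔-updates M₃ q _ j ⟩
      -1ℤ * M₃ q j                            ≡⟨ cong (-1ℤ *_) ([]≔-minimal M₂ _ q≢p j) ⟩
      -1ℤ * M₂ q j                            ≡⟨ cong (-1ℤ *_) ([]≔-updates M₁ q _ j) ⟩
      -1ℤ * (M₁ q j + -1ℤ * M₁ p j)           ≡⟨ cong₂ (λ a b → -1ℤ * (b + -1ℤ * a))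
                                                        ([]≔-updates M p _ j) ([]≔-minimal M _ q≢p j) ⟩
      -1ℤ * (v + -1ℤ * (u + 1ℤ * v))          ≡⟨ solve₂ u v ⟩
      u ∎
      where u = M p j; v = M q j
            solve₂ : ∀ u v → -1ℤ * (v + -1ℤ * (u + 1ℤ * v)) ≡ u
            solve₂ = solve-∀
    Ri≡Mi : ∀ {i} → i ≢ p → i ≢ q → ∀ j → R i j ≡ M i j
    Ri≡Mi i≢p i≢q j =
      trans ([]≔-minimal M₃ _ i≢q j) (trans ([]≔-minimal M₂ _ i≢p j)
        (trans ([]≔-minimal M₁ _ i≢q j) ([]≔-minimal M _ i≢p j)))
    swapped : ∀ i j → M (transpose p q i) j ≡ R i j
    swapped i j = entry (i Fin.≟ p) (i Fin.≟ q)
      where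
      at : ∀ {k} → i ≡ k → M (transpose p q k) j ≡ R k j → M (transpose p q i) j ≡ R i j
      at refl eq = eq
      entry : Dec (i ≡ p) → Dec (i ≡ q) → M (transpose p q i) j ≡ R i j
      entry (yes i≡p) _         = at i≡p (trans (cong (λ k → M k j) (transpose-matchˡ p q)) (sym (Rp≡Mq j)))
      entry (no _)    (yes i≡q) = at i≡q (trans (cong (λ k → M k j) (transpose-matchʳ p q)) (sym (Rq≡Mp j)))
      entry (no i≢p)  (no i≢q)  =
        trans (cong (λ k → M k j) (transpose-mismatch p q i i≢p i≢q)) (sym (Ri≡Mi i≢p i≢q j))

  ∣unit*∣ : ∀ {ε} x → ∣ ε ∣ ≡ 1 → ∣ ε * x ∣ ≡ ∣ x ∣
  ∣unit*∣ {ε} x ∣ε∣≡1 = trans (abs-* ε x) (trans (cong (ℕ._* ∣ x ∣) ∣ε∣≡1) (ℕ.*-identityˡ ∣ x ∣))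

  det-transposeRows : ∀ {n} (p q : Fin n) →
    Σ ℤ λ ε → ∣ ε ∣ ≡ 1 × (∀ M → det (M ∘ transpose p q) ≡ ε * det M)
  det-transposeRows p q with p Fin.≟ q
  ... | yes refl = 1ℤ , refl , λ M →
    trans (det-cong (λ i j → cong (λ k → M k j) (transpose-self p i))) (sym (*-identityˡ (det M)))
  ... | no p≢q = -1ℤ , refl , λ M → trans (det-swapRows M p≢q) (sym (-1*i≡-i (det M)))

  det-permuteRows : ∀ {n} {π : Fin n → Fin n} → Injective _≡_ _≡_ π →
    Σ ℤ λ ε → ∣ ε ∣ ≡ 1 × (∀ M → det (M ∘ π) ≡ ε * det M)
  det-permuteRows {zero}        _     = 1ℤ , refl , λ M → refl
  det-permuteRows {suc n} {π} π-inj = ε′ * εₜ , ∣ε′εₜ∣≡1 , permute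
    where
    t = π zero
    π′ : Fin (suc n) → Fin (suc n)
    π′ = transpose t zero ∘ π
    π′-injective : Injective _≡_ _≡_ π′
    π′-injective {i} {j} eq = π-inj (begin
      π i                                   ≡⟨ transpose-inverse zero t {π i} ⟨
      transpose zero t (π′ i)               ≡⟨ cong (transpose zero t) eq ⟩
      transpose zero t (π′ j)               ≡⟨ transpose-inverse zero t {π j} ⟩
      π j                                   ∎)
      where open ≡-Reasoning
    π′₀≡0 : π′ zero ≡ zero
    π′₀≡0 = transpose-matchˡ t zero
    ρ = remove₀ π′-injective
    suc∘ρ≡π′∘suc : ∀ i → suc (ρ i) ≡ π′ (suc i)
    suc∘ρ≡π′∘suc i = trans (cong (λ z → punchIn z (ρ i)) (sym π′₀≡0)) (punchIn-remove₀ π′-injective i)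
    IH = det-permuteRows (remove₀-injective π′-injective)
    ε′ = proj₁ IH
    Tₜ = det-transposeRows zero t
    εₜ = proj₁ Tₜ
    ∣ε′εₜ∣≡1 : ∣ ε′ * εₜ ∣ ≡ 1
    ∣ε′εₜ∣≡1 = trans (abs-* ε′ εₜ) (cong₂ ℕ._*_ (proj₁ (proj₂ IH)) (proj₁ (proj₂ Tₜ)))
    permute : ∀ M → det (M ∘ π) ≡ (ε′ * εₜ) * det M
    permute M = begin
      det (M ∘ π)
        ≡⟨ det-cong (λ i j → cong (λ k → M k j) (sym (transpose-inverse zero t {π i}))) ⟩
      det (N ∘ π′)
        ≡⟨ sumFin-cong (λ j → cong₂ (λ a d → sign (toℕ j) * (a * d)) (cong (λ k → N k j) π′₀≡0)
             (trans (det-cong (λ i k → cong (λ r → N r (punchIn j k)) (sym (suc∘ρ≡π′∘suc i))))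
                    (proj₂ (proj₂ IH) (minor j N)))) ⟩
      sumFin (λ j → sign (toℕ j) * (N zero j * (ε′ * det (minor j N))))
        ≡⟨ sumFin-cong (λ j → pull (sign (toℕ j)) (N zero j) ε′ (det (minor j N))) ⟩
      sumFin (λ j → ε′ * (sign (toℕ j) * (N zero j * det (minor j N))))
        ≡⟨ *-distribˡ-sumFin ε′ (λ j → sign (toℕ j) * (N zero j * det (minor j N))) ⟨
      ε′ * det N
        ≡⟨ cong (ε′ *_) (proj₂ (proj₂ Tₜ) M) ⟩
      ε′ * (εₜ * det M)
        ≡⟨ *-assoc ε′ εₜ (det M) ⟨
      (ε′ * εₜ) * det M ∎
      where
      open ≡-Reasoning
      N = M ∘ transpose zero t
      pull : ∀ s a e d → s * (a * (e * d)) ≡ e * (s * (a * d))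
      pull = solve-∀

  ∣det∣-permuteRows : ∀ {n} {π : Fin n → Fin n} → Injective _≡_ _≡_ π → (M : Matrix n) →
    ∣ det (M ∘ π) ∣ ≡ ∣ det M ∣
  ∣det∣-permuteRows π-inj M with det-permuteRows π-inj
  ... | ε , ∣ε∣≡1 , permute = trans (cong ∣_∣ (permute M)) (∣unit*∣ {ε} (det M) ∣ε∣≡1)

  ∣sign∣≡1 : ∀ k → ∣ sign k ∣ ≡ 1
  ∣sign∣≡1 zero    = refl
  ∣sign∣≡1 (suc k) = trans (∣-i∣≡∣i∣ (sign k)) (∣sign∣≡1 k)

  det-zeroColumn : ∀ {n} (M : Matrix n) c → (∀ i → M i c ≡ 0ℤ) → det M ≡ 0ℤ
  det-zeroColumn {suc n} M c column≡0 = sumFin-zero term≡0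
    where
    term≡0 : ∀ j → sign (toℕ j) * (M zero j * det (minor j M)) ≡ 0ℤ
    term≡0 j with j Fin.≟ c
    ... | yes refl = trans (cong (λ a → sign (toℕ j) * (a * det (minor j M))) (column≡0 zero))
                           (*-zeroʳ (sign (toℕ j)))
    ... | no  j≢c  = trans (cong (λ d → sign (toℕ j) * (M zero j * d))
                                 (det-zeroColumn (minor j M) (punchOut j≢c) λ i →
                                    trans (cong (M (suc i)) (Fin.punchIn-punchOut j≢c)) (column≡0 (suc i))))
                           (*-zeroʳ² (sign (toℕ j)) (M zero j))

  -- Only the term j = σ 0 of the first-row expansion survives.
  ∣det∣-triangular : ∀ {n} (M : Matrix n) {σ : Fin n → Fin n} → Injective _≡_ _≡_ σ →
    (∀ {i i′} → toℕ i < toℕ i′ → M i′ (σ i) ≡ 0ℤ) → ∣ det M ∣ ≡ ∣ product (λ i → M i (σ i)) ∣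
  ∣det∣-triangular {zero}  M _ _ = refl
  ∣det∣-triangular {suc n} M {σ} σ-inj below = begin
    ∣ det M ∣
      ≡⟨ cong ∣_∣ (sumFin-single t (λ j → sign (toℕ j) * (M zero j * det (minor j M))) offDiagonal) ⟩
    ∣ sign (toℕ t) * (M zero t * det (minor t M)) ∣
      ≡⟨ ∣unit*∣ {sign (toℕ t)} (M zero t * det (minor t M)) (∣sign∣≡1 (toℕ t)) ⟩
    ∣ M zero t * det (minor t M) ∣
      ≡⟨ abs-* (M zero t) (det (minor t M)) ⟩
    ∣ M zero t ∣ ℕ.* ∣ det (minor t M) ∣
      ≡⟨ cong (∣ M zero t ∣ ℕ.*_) IH ⟩
    ∣ M zero t ∣ ℕ.* ∣ product (λ i → minor t M i (σ′ i)) ∣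
      ≡⟨ abs-* (M zero t) (product (λ i → minor t M i (σ′ i))) ⟨
    ∣ M zero t * product (λ i → minor t M i (σ′ i)) ∣
      ≡⟨ cong (λ p → ∣ M zero t * p ∣) (product-cong (λ i → cong (M (suc i)) (punchIn-remove₀ σ-inj i))) ⟩
    ∣ product (λ i → M i (σ i)) ∣ ∎
    where
    open ≡-Reasoning
    t = σ zero
    σ′ = remove₀ σ-inj
    IH = ∣det∣-triangular (minor t M) (remove₀-injective σ-inj) λ {i} {i′} i<i′ →
           trans (cong (M (suc i′)) (punchIn-remove₀ σ-inj i)) (below (s≤s i<i′))
    offDiagonal : ∀ j → j ≢ t → sign (toℕ j) * (M zero j * det (minor j M)) ≡ 0ℤ
    offDiagonal j j≢t = trans
      (cong (λ d → sign (toℕ j) * (M zero j * d))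
            (det-zeroColumn (minor j M) (punchOut j≢t)
               (λ i → trans (cong (M (suc i)) (Fin.punchIn-punchOut j≢t)) (below (s≤s z≤n)))))
      (*-zeroʳ² (sign (toℕ j)) (M zero j))

  addRows : ∀ {n} → (Fin n → Fin n → ℤ) → Matrix n → Matrix n
  addRows T M k j = M k j + sumFin (λ l → T k l * M l j)

  StrictlyLower : ∀ {n} → (Fin n → Fin n → ℤ) → Set
  StrictlyLower T = ∀ {k l} → toℕ k ≤ toℕ l → T k l ≡ 0ℤ

  module _ {n} (T : Fin n → Fin n → ℤ) (lower : StrictlyLower T) (M : Matrix n) where

    addRowsFrom : ℕ → Matrix n
    addRowsFrom t k with t ℕ.≤? toℕ k
    ... | yes _ = addRows T M k
    ... | no  _ = M k

    addRowsFrom-≤ : ∀ {t k} → t ≤ toℕ k → ∀ j → addRowsFrom t k j ≡ addRows T M k j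
    addRowsFrom-≤ {t} {k} t≤k j with t ℕ.≤? toℕ k
    ... | yes _   = refl
    ... | no  t≰k = ⊥-elim (t≰k t≤k)

    addRowsFrom-≰ : ∀ {t k} → ¬ t ≤ toℕ k → ∀ j → addRowsFrom t k j ≡ M k j
    addRowsFrom-≰ {t} {k} t≰k j with t ℕ.≤? toℕ k
    ... | yes t≤k = ⊥-elim (t≰k t≤k)
    ... | no  _   = refl

    -- Passing from t+1 to t adds to row t a combination of the rows above it, which are
    -- still those of M.
    det-addRowsFrom-step : ∀ {t} (t<n : t < n) → det (addRowsFrom t) ≡ det (addRowsFrom (suc t))
    det-addRowsFrom-step {t} t<n =
      trans (det-cong entry) (det-addCombinationTo S k₀ (T k₀) (lower ℕ.≤-refl))
      where
      S = addRowsFrom (suc t)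
      k₀ = Fin.fromℕ< t<n
      k₀≡t : toℕ k₀ ≡ t
      k₀≡t = Fin.toℕ-fromℕ< t<n
      above : ∀ j l → T k₀ l * M l j ≡ T k₀ l * S l j
      above j l = case (suc t ℕ.≤? toℕ l)
        where
        case : Dec (t < toℕ l) → T k₀ l * M l j ≡ T k₀ l * S l j
        case (yes t<l) rewrite lower (ℕ.≤-trans (ℕ.≤-reflexive k₀≡t) (ℕ.<⇒≤ t<l)) = refl
        case (no  t≮l) = cong (T k₀ l *_) (sym (addRowsFrom-≰ t≮l j))
      entry : ∀ k j → addRowsFrom t k j ≡ (S [ k₀ ]≔ (λ j → S k₀ j + sumFin (λ l → T k₀ l * S l j))) k j
      entry k j with k Fin.≟ k₀
      ... | yes refl = trans (addRowsFrom-≤ (ℕ.≤-reflexive (sym k₀≡t)) j) (sym (trans ([]≔-updates S k₀ _ j)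
              (cong₂ _+_ (addRowsFrom-≰ (λ t<k₀ → ℕ.<-irrefl (sym k₀≡t) t<k₀) j)
                         (sumFin-cong (λ l → sym (above j l))))))
      ... | no  k≢k₀ = trans (shift (t ℕ.≤? toℕ k)) (sym ([]≔-minimal S _ k≢k₀ j))
        where
        k≢t : toℕ k ≢ t
        k≢t k≡t = k≢k₀ (Fin.toℕ-injective (trans k≡t (sym k₀≡t)))
        shift : Dec (t ≤ toℕ k) → addRowsFrom t k j ≡ S k j
        shift (yes t≤k) = trans (addRowsFrom-≤ t≤k j) (sym (addRowsFrom-≤ (ℕ.≤∧≢⇒< t≤k (k≢t ∘ sym)) j))
        shift (no  t≰k) = trans (addRowsFrom-≰ t≰k j) (sym (addRowsFrom-≰ (t≰k ∘ ℕ.<⇒≤) j))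

    det-addRowsFrom : ∀ t d → t ℕ.+ d ≡ n → det (addRowsFrom t) ≡ det M
    det-addRowsFrom t zero    t+0≡n = det-cong λ k → addRowsFrom-≰ λ t≤k →
      ℕ.<-irrefl refl (ℕ.<-≤-trans (Fin.toℕ<n k) (subst (_≤ toℕ k) (trans (sym (ℕ.+-identityʳ t)) t+0≡n) t≤k))
    det-addRowsFrom t (suc d) t+d≡n =
      trans (det-addRowsFrom-step t<n) (det-addRowsFrom (suc t) d (trans (sym (ℕ.+-suc t d)) t+d≡n))
      where t<n = subst (t <_) t+d≡n (ℕ.m<m+n t (s≤s z≤n))

  det-addRows : ∀ {n} (T : Fin n → Fin n → ℤ) → StrictlyLower T → (M : Matrix n) →
    det (addRows T M) ≡ det M
  det-addRows {n} T lower M =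
    trans (det-cong (λ k → sym ∘ addRowsFrom-≤ T lower M z≤n)) (det-addRowsFrom T lower M 0 n refl)

module Indicator where

  open import Data.Nat using (_∸_; _<?_; _≤?_; _≟_)
  open import Data.Integer using (ℤ; +_; -_; _+_; _-_; _*_; 0ℤ; 1ℤ)
  open import Data.Integer.Properties using (+-inverseʳ; *-zeroˡ; +-identityˡ)
  open import Data.Integer.Tactic.RingSolver using (solve-∀)
  open import Relation.Nullary.Decidable using (_×-dec_)
  open Determinant using (sumFin-cong; sumFin-zero)

  𝟙 : ∀ {P : Set} → Dec P → ℤ
  𝟙 (yes _) = 1ℤ
  𝟙 (no  _) = 0ℤ

  𝟙-yes : ∀ {P : Set} (d : Dec P) → P → 𝟙 d ≡ 1ℤ
  𝟙-yes (yes _) _ = refl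
  𝟙-yes (no ¬p) p = ⊥-elim (¬p p)

  𝟙-no : ∀ {P : Set} (d : Dec P) → ¬ P → 𝟙 d ≡ 0ℤ
  𝟙-no (yes p) ¬p = ⊥-elim (¬p p)
  𝟙-no (no  _) _  = refl

  𝟙-cong : ∀ {P Q : Set} (d : Dec P) (e : Dec Q) → (P → Q) → (Q → P) → 𝟙 d ≡ 𝟙 e
  𝟙-cong (yes _) (yes _) _   _   = refl
  𝟙-cong (yes p) (no ¬q) p→q _   = ⊥-elim (¬q (p→q p))
  𝟙-cong (no ¬p) (yes q) _   q→p = ⊥-elim (¬p (q→p q))
  𝟙-cong (no _)  (no _)  _   _   = refl

  𝟙-suc-< : ∀ x b → 𝟙 (suc x <? suc b) ≡ 𝟙 (x <? b)
  𝟙-suc-< x b = 𝟙-cong (suc x <? suc b) (x <? b) s<s⁻¹ s≤s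

  Window : ℕ → ℕ → ℕ → Set
  Window a b x = a ≤ x × x < b

  window? : ∀ a b x → Dec (Window a b x)
  window? a b x = (a ≤? x) ×-dec (x <? b)

  𝟙-window : ∀ {a b} x → a ≤ b → 𝟙 (window? a b x) ≡ 𝟙 (x <? b) - 𝟙 (x <? a)
  𝟙-window {a} {b} x a≤b with a ≤? x | x <? b | x <? a
  ... | yes a≤x | _       | yes x<a = ⊥-elim (ℕ.<-irrefl refl (ℕ.<-≤-trans x<a a≤x))
  ... | yes _   | yes _   | no  _   = refl
  ... | yes _   | no  _   | no  _   = refl
  ... | no  _   | yes _   | yes _   = refl
  ... | no  _   | no  x≮b | yes x<a = ⊥-elim (x≮b (ℕ.<-≤-trans x<a a≤b))
  ... | no  a≰x | _       | no  x≮a = ⊥-elim (a≰x (ℕ.≮⇒≥ x≮a))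

  𝟙-<-step : ∀ x b → 𝟙 (x <? b) - 𝟙 (suc x <? b) ≡ 𝟙 (suc x ≟ b)
  𝟙-<-step x b with x <? b | suc x <? b | suc x ≟ b
  ... | yes _   | yes x+1<b | yes refl = ⊥-elim (ℕ.<-irrefl refl x+1<b)
  ... | yes _   | yes _     | no  _    = refl
  ... | yes _   | no  _     | yes _    = refl
  ... | yes x<b | no  x+1≮b | no  x+1≢b = ⊥-elim (x+1≢b (ℕ.≤-antisym x<b (ℕ.≮⇒≥ x+1≮b)))
  ... | no  x≮b | yes x+1<b | _        = ⊥-elim (x≮b (ℕ.<-trans (ℕ.n<1+n x) x+1<b))
  ... | no  x≮b | no  _     | yes refl = ⊥-elim (x≮b (ℕ.n<1+n x))
  ... | no  _   | no  _     | no  _    = refl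

  𝟙-window-step : ∀ {a b} x → a ≤ b →
    𝟙 (window? a b x) - 𝟙 (window? a b (suc x)) ≡ 𝟙 (suc x ≟ b) - 𝟙 (suc x ≟ a)
  𝟙-window-step {a} {b} x a≤b = begin
    𝟙 (window? a b x) - 𝟙 (window? a b (suc x))
      ≡⟨ cong₂ _-_ (𝟙-window x a≤b) (𝟙-window (suc x) a≤b) ⟩
    (𝟙 (x <? b) - 𝟙 (x <? a)) - (𝟙 (suc x <? b) - 𝟙 (suc x <? a))
      ≡⟨ regroup (𝟙 (x <? b)) (𝟙 (x <? a)) (𝟙 (suc x <? b)) (𝟙 (suc x <? a)) ⟩
    (𝟙 (x <? b) - 𝟙 (suc x <? b)) - (𝟙 (x <? a) - 𝟙 (suc x <? a))
      ≡⟨ cong₂ _-_ (𝟙-<-step x b) (𝟙-<-step x a) ⟩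
    𝟙 (suc x ≟ b) - 𝟙 (suc x ≟ a) ∎
    where
    open ≡-Reasoning
    regroup : ∀ p q r t → (p - q) - (r - t) ≡ (p - r) - (q - t)
    regroup = solve-∀

  sumFin-< : ∀ {n} b → b ≤ n → sumFin {n} (λ j → 𝟙 (toℕ j <? b)) ≡ + b
  sumFin-< {n}     zero    _         = sumFin-zero {n} (λ j → 𝟙-no (toℕ j <? 0) λ ())
  sumFin-< {suc n} (suc b) (s≤s b≤n) =
    cong (λ x → 1ℤ + x) (trans (sumFin-cong {n} (λ j → 𝟙-suc-< (toℕ j) b)) (sumFin-< b b≤n))

  sumFin-window : ∀ {n} a b → a ≤ b → b ≤ n → sumFin {n} (λ j → 𝟙 (window? a b (toℕ j))) ≡ + (b ∸ a)
  sumFin-window {n}     zero    b       _         b≤n = trans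
    (sumFin-cong {n} (λ j → 𝟙-cong (window? 0 b (toℕ j)) (toℕ j <? b) proj₂ (z≤n ,_))) (sumFin-< b b≤n)
  sumFin-window {suc n} (suc a) (suc b) (s≤s a≤b) (s≤s b≤n) = begin
    𝟙 (window? (suc a) (suc b) 0) + sumFin {n} (λ j → 𝟙 (window? (suc a) (suc b) (suc (toℕ j))))
      ≡⟨ cong₂ _+_ (𝟙-no (window? (suc a) (suc b) 0) (λ ()))
                    (sumFin-cong {n} λ j →
                       𝟙-cong (window? (suc a) (suc b) (suc (toℕ j))) (window? a b (toℕ j))
                              (λ (a<j , j<b) → s≤s⁻¹ a<j , s<s⁻¹ j<b) (λ (a≤j , j<b) → s≤s a≤j , s≤s j<b)) ⟩
    0ℤ + sumFin {n} (λ j → 𝟙 (window? a b (toℕ j)))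
      ≡⟨ trans (+-identityˡ _) (sumFin-window a b a≤b b≤n) ⟩
    + (b ∸ a) ∎
    where open ≡-Reasoning

  sumFin-telescope : ∀ {n} K (g : ℕ → ℤ) → K ≤ n →
    sumFin {n} (λ l → 𝟙 (toℕ l <? K) * (g (suc (toℕ l)) - g (toℕ l))) ≡ g K - g 0
  sumFin-telescope {n} zero g _ =
    trans (sumFin-zero {n} (λ l → cong (_* (g (suc (toℕ l)) - g (toℕ l))) (𝟙-no (toℕ l <? 0) λ ())))
          (sym (+-inverseʳ (g 0)))
  sumFin-telescope {suc n} (suc K) g (s≤s K≤n) = begin
    1ℤ * Δ 0 + sumFin {n} (λ l → 𝟙 (suc (toℕ l) <? suc K) * Δ (suc (toℕ l)))
      ≡⟨ cong (λ x → 1ℤ * Δ 0 + x)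
              (trans (sumFin-cong {n} (λ l → cong (_* Δ (suc (toℕ l))) (𝟙-suc-< (toℕ l) K)))
                     (sumFin-telescope K (g ∘ suc) K≤n)) ⟩
    1ℤ * Δ 0 + (g (suc K) - g 1)
      ≡⟨ collapse (g 0) (g 1) (g (suc K)) ⟩
    g (suc K) - g 0 ∎
    where
    open ≡-Reasoning
    Δ : ℕ → ℤ
    Δ x = g (suc x) - g x
    collapse : ∀ x y z → 1ℤ * (y - x) + (z - y) ≡ z - x
    collapse = solve-∀

module Cyclic (m₁ : ℕ) where

  open import Data.Nat using (_+_; _*_; _∸_; _%_)
  open import Data.Nat.DivMod
  open import Data.Nat.Divisibility using (_∣_; divides; ∣⇒≤)
  open import Data.Nat.Coprimality using (coprime-divisor)
  open import Data.Nat.Tactic.RingSolver using (solve-∀)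
  open import Data.Sum using (inj₁; inj₂)

  m : ℕ
  m = suc m₁

  %-absorbˡ : ∀ a b → (a % m + b) % m ≡ (a + b) % m
  %-absorbˡ a b = begin
    (a % m + b) % m                ≡⟨ %-distribˡ-+ (a % m) b m ⟩
    (a % m % m + b % m) % m        ≡⟨ cong (λ x → (x + b % m) % m) (m%n%n≡m%n a m) ⟩
    (a % m + b % m) % m            ≡⟨ %-distribˡ-+ a b m ⟨
    (a + b) % m                    ∎
    where open ≡-Reasoning

  %≡⇒∣∸ : ∀ {a b} → a ≤ b → a % m ≡ b % m → m ∣ b ∸ a
  %≡⇒∣∸ {a} {b} a≤b a%m≡b%m = divides (b / m ∸ a / m) (begin
    b ∸ a                                     ≡⟨ cong₂ _∸_ (m≡m%n+[m/n]*n b m) (m≡m%n+[m/n]*n a m) ⟩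
    (b % m + b / m * m) ∸ (a % m + a / m * m) ≡⟨ cong (λ r → (b % m + b / m * m) ∸ (r + a / m * m)) a%m≡b%m ⟩
    (b % m + b / m * m) ∸ (b % m + a / m * m) ≡⟨ ℕ.[m+n]∸[m+o]≡n∸o (b % m) _ _ ⟩
    b / m * m ∸ a / m * m                     ≡⟨ ℕ.*-distribʳ-∸ m (b / m) (a / m) ⟨
    (b / m ∸ a / m) * m                       ∎)
    where open ≡-Reasoning

  ∣∧<⇒≡0 : ∀ {d} → m ∣ d → d < m → d ≡ 0
  ∣∧<⇒≡0 {zero}  _   _   = refl
  ∣∧<⇒≡0 {suc d} m∣d d<m = ⊥-elim (ℕ.<-irrefl refl (ℕ.<-≤-trans d<m (∣⇒≤ m∣d)))

  position : Fin m → Fin m → ℕ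
  position i j = (toℕ j + (m ∸ toℕ i)) % m

  position<m : ∀ i j → position i j < m
  position<m i j = m%n<n (toℕ j + (m ∸ toℕ i)) m

  position-zero : ∀ j → position zero j ≡ toℕ j
  position-zero j = trans ([m+n]%n≡m%n (toℕ j) m) (m<n⇒m%n≡m (Fin.toℕ<n j))

  private
    i+[m∸i]≡m : ∀ (i : Fin m) → toℕ i + (m ∸ toℕ i) ≡ m
    i+[m∸i]≡m i = ℕ.m+[n∸m]≡n (ℕ.<⇒≤ (Fin.toℕ<n i))

  position≡⇒ : ∀ i j {p} → position i j ≡ p → toℕ j ≡ (toℕ i + p) % m
  position≡⇒ i j refl = sym (begin
    (toℕ i + (toℕ j + (m ∸ toℕ i)) % m) % m   ≡⟨ cong (_% m) (ℕ.+-comm (toℕ i) _) ⟩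
    ((toℕ j + (m ∸ toℕ i)) % m + toℕ i) % m   ≡⟨ %-absorbˡ (toℕ j + (m ∸ toℕ i)) (toℕ i) ⟩
    (toℕ j + (m ∸ toℕ i) + toℕ i) % m         ≡⟨ cong (_% m) (regroup (toℕ j) (m ∸ toℕ i) (toℕ i)) ⟩
    (toℕ j + (toℕ i + (m ∸ toℕ i))) % m       ≡⟨ cong (λ x → (toℕ j + x) % m) (i+[m∸i]≡m i) ⟩
    (toℕ j + m) % m                           ≡⟨ position-zero j ⟩
    toℕ j                                     ∎)
    where
    open ≡-Reasoning
    regroup : ∀ a b c → a + b + c ≡ a + (c + b)
    regroup = solve-∀

  position≡⇐ : ∀ i j {p} → p < m → toℕ j ≡ (toℕ i + p) % m → position i j ≡ p
  position≡⇐ i j {p} p<m j≡i+p = begin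
    (toℕ j + (m ∸ toℕ i)) % m                 ≡⟨ cong (λ x → (x + (m ∸ toℕ i)) % m) j≡i+p ⟩
    ((toℕ i + p) % m + (m ∸ toℕ i)) % m       ≡⟨ %-absorbˡ (toℕ i + p) (m ∸ toℕ i) ⟩
    (toℕ i + p + (m ∸ toℕ i)) % m             ≡⟨ cong (_% m) (regroup (toℕ i) p (m ∸ toℕ i)) ⟩
    (p + (toℕ i + (m ∸ toℕ i))) % m           ≡⟨ cong (λ x → (p + x) % m) (i+[m∸i]≡m i) ⟩
    (p + m) % m                               ≡⟨ [m+n]%n≡m%n p m ⟩
    p % m                                     ≡⟨ m<n⇒m%n≡m p<m ⟩
    p                                         ∎
    where
    open ≡-Reasoning
    regroup : ∀ a b c → a + b + c ≡ b + (a + c)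
    regroup = solve-∀

  position-pred : ∀ {k l : Fin m} → toℕ k ≡ suc (toℕ l) → ∀ j → position l j ≡ suc (position k j) % m
  position-pred {k} {l} k≡1+l j = begin
    (toℕ j + (m ∸ toℕ l)) % m                 ≡⟨ cong (λ x → (toℕ j + x) % m) m∸l≡1+[m∸k] ⟩
    (toℕ j + suc (m ∸ toℕ k)) % m             ≡⟨ cong (_% m) (ℕ.+-suc (toℕ j) (m ∸ toℕ k)) ⟩
    suc y % m                                 ≡⟨ cong (_% m) (ℕ.+-comm 1 y) ⟩
    (y + 1) % m                               ≡⟨ %-absorbˡ y 1 ⟨
    (y % m + 1) % m                           ≡⟨ cong (_% m) (ℕ.+-comm (y % m) 1) ⟩
    suc (y % m) % m                           ∎
    where
    open ≡-Reasoning
    y = toℕ j + (m ∸ toℕ k)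
    m∸l≡1+[m∸k] : m ∸ toℕ l ≡ suc (m ∸ toℕ k)
    m∸l≡1+[m∸k] = trans (ℕ.+-∸-assoc 1 (ℕ.<⇒≤ (s≤s⁻¹ (subst (_< m) k≡1+l (Fin.toℕ<n k)))))
                        (cong (λ x → suc (m ∸ x)) (sym k≡1+l))

  module Orbit (s : ℕ) (coprime : Coprime m s) where

    orbit : ℕ → ℕ → Fin m
    orbit c x = (x * s + c) mod m

    toℕ-orbit : ∀ c x → toℕ (orbit c x) ≡ (x * s + c) % m
    toℕ-orbit c x = Fin.toℕ-fromℕ< (m%n<n (x * s + c) m)

    orbit-suc : ∀ c x → orbit c (suc x) ≡ orbit (s + c) x
    orbit-suc c x = cong (_mod m) (regroup s x c)
      where
      regroup : ∀ s x c → s + x * s + c ≡ x * s + (s + c)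
      regroup = solve-∀

    orbit-period : ∀ c → orbit c m ≡ orbit c 0
    orbit-period c = Fin.toℕ-injective (begin
      toℕ (orbit c m)       ≡⟨ toℕ-orbit c m ⟩
      (m * s + c) % m       ≡⟨ cong (_% m) (ℕ.+-comm (m * s) c) ⟩
      (c + m * s) % m       ≡⟨ cong (λ x → (c + x) % m) (ℕ.*-comm m s) ⟩
      (c + s * m) % m       ≡⟨ [m+kn]%n≡m%n c s m ⟩
      c % m                 ≡⟨ toℕ-orbit c 0 ⟨
      toℕ (orbit c 0)       ∎)
      where open ≡-Reasoning

    private
      orbit-injective-≤ : ∀ {c x y} → x ≤ y → y < m → orbit c x ≡ orbit c y → x ≡ y
      orbit-injective-≤ {c} {x} {y} x≤y y<m eq = ℕ.≤-antisym x≤y (ℕ.m∸n≡0⇒m≤n y∸x≡0)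
        where
        m∣[y∸x]*s : m ∣ (y ∸ x) * s
        m∣[y∸x]*s = subst (m ∣_) (trans (ℕ.[m+n]∸[m+o]≡n∸o c (y * s) (x * s)) (sym (ℕ.*-distribʳ-∸ s y x)))
          (subst₂ (λ a b → m ∣ a ∸ b) (ℕ.+-comm (y * s) c) (ℕ.+-comm (x * s) c)
            (%≡⇒∣∸ (ℕ.+-monoˡ-≤ c (ℕ.*-monoˡ-≤ s x≤y))
                   (trans (sym (toℕ-orbit c x)) (trans (cong toℕ eq) (toℕ-orbit c y)))))
        y∸x≡0 : y ∸ x ≡ 0
        y∸x≡0 = ∣∧<⇒≡0 (coprime-divisor coprime (subst (m ∣_) (ℕ.*-comm (y ∸ x) s) m∣[y∸x]*s))
                       (ℕ.≤-<-trans (ℕ.m∸n≤m y x) y<m)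

    orbit-injective : ∀ {c x y} → x < m → y < m → orbit c x ≡ orbit c y → x ≡ y
    orbit-injective {x = x} {y} x<m y<m eq with ℕ.≤-total x y
    ... | inj₁ x≤y = orbit-injective-≤ x≤y y<m eq
    ... | inj₂ y≤x = sym (orbit-injective-≤ y≤x x<m (sym eq))

    position-orbit⇒ : ∀ c x j {p} → position (orbit c x) j ≡ p → j ≡ orbit (c + p) x
    position-orbit⇒ c x j {p} eq = Fin.toℕ-injective (begin
      toℕ j                                  ≡⟨ position≡⇒ (orbit c x) j eq ⟩
      (toℕ (orbit c x) + p) % m              ≡⟨ cong (λ y → (y + p) % m) (toℕ-orbit c x) ⟩
      ((x * s + c) % m + p) % m              ≡⟨ %-absorbˡ (x * s + c) p ⟩
      (x * s + c + p) % m                    ≡⟨ cong (_% m) (ℕ.+-assoc (x * s) c p) ⟩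
      (x * s + (c + p)) % m                  ≡⟨ toℕ-orbit (c + p) x ⟨
      toℕ (orbit (c + p) x)                  ∎)
      where open ≡-Reasoning

    position-orbit⇐ : ∀ c x j {p} → p < m → j ≡ orbit (c + p) x → position (orbit c x) j ≡ p
    position-orbit⇐ c x j {p} p<m refl = position≡⇐ (orbit c x) j p<m (begin
      toℕ (orbit (c + p) x)                  ≡⟨ toℕ-orbit (c + p) x ⟩
      (x * s + (c + p)) % m                  ≡⟨ cong (_% m) (ℕ.+-assoc (x * s) c p) ⟨
      (x * s + c + p) % m                    ≡⟨ %-absorbˡ (x * s + c) p ⟨
      ((x * s + c) % m + p) % m              ≡⟨ cong (λ y → (y + p) % m) (toℕ-orbit c x) ⟨
      (toℕ (orbit c x) + p) % m              ∎)
      where open ≡-Reasoning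

module WindowCirculant (m₁ v s : ℕ) (fits : v ℕ.+ s ≤ m₁) where

  open import Data.Integer using (ℤ; +_; -_; _+_; _-_; _*_; 0ℤ; 1ℤ; -1ℤ)
  open import Data.Integer.Properties
  open import Data.Integer.Tactic.RingSolver using (solve-∀)
  open import Data.Nat.DivMod using (m<n⇒m%n≡m; n%n≡0)
  open Determinant
  open Indicator
  open Cyclic m₁

  start end : ℕ
  start = suc v
  end   = suc (v ℕ.+ s)

  start≤end : start ≤ end
  start≤end = s≤s (ℕ.m≤m+n v s)

  end≤m : end ≤ m
  end≤m = s≤s fits

  W : Matrix m
  W i j = 𝟙 (window? start end (position i j))

  W-wrap : ∀ y → y < m → 𝟙 (window? start end (suc y ℕ.% m)) ≡ 𝟙 (window? start end (suc y))
  W-wrap y y<m with suc y ℕ.<? m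
  ... | yes y+1<m = cong (λ x → 𝟙 (window? start end x)) (m<n⇒m%n≡m y+1<m)
  ... | no  y+1≮m =
    trans (𝟙-no (window? start end (suc y ℕ.% m)) 0∉window) (sym (𝟙-no (window? start end (suc y)) m∉window))
    where
    y+1≡m = ℕ.≤-antisym y<m (ℕ.≮⇒≥ y+1≮m)
    0∉window : ¬ Window start end (suc y ℕ.% m)
    0∉window (start≤ , _) with () ← subst (start ≤_) (trans (cong (ℕ._% m) y+1≡m) (n%n≡0 m)) start≤
    m∉window : ¬ Window start end (suc y)
    m∉window (_ , <end) = ℕ.<-irrefl refl (ℕ.<-≤-trans (subst (_< end) y+1≡m <end) end≤m)

  previousRow : Fin m → Fin m → ℤ
  previousRow k l = - 𝟙 (toℕ k ℕ.≟ suc (toℕ l))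

  previousRow-lower : StrictlyLower previousRow
  previousRow-lower {k} {l} k≤l =
    cong -_ (𝟙-no (toℕ k ℕ.≟ suc (toℕ l)) (λ k≡1+l → ℕ.<-irrefl refl (subst (_≤ toℕ l) k≡1+l k≤l)))

  D : Matrix m
  D = addRows previousRow W

  D-zero : ∀ j → D zero j ≡ W zero j
  D-zero j = trans (cong (λ x → W zero j + x) (sumFin-zero λ l →
                      trans (cong (λ x → - x * W l j) (𝟙-no (0 ℕ.≟ suc (toℕ l)) λ ())) (*-zeroˡ (W l j))))
                   (+-identityʳ (W zero j))

  D-suc : ∀ i j → D (suc i) j ≡ 𝟙 (position (suc i) j ℕ.≟ v ℕ.+ s) - 𝟙 (position (suc i) j ℕ.≟ v)
  D-suc i j = begin
    W k j + sumFin (λ l → previousRow k l * W l j)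
      ≡⟨ cong (λ x → W k j + x) (sumFin-single l₀ (λ l → previousRow k l * W l j) others) ⟩
    W k j + - 𝟙 (toℕ k ℕ.≟ suc (toℕ l₀)) * W l₀ j
      ≡⟨ cong (λ x → W k j + - x * W l₀ j) (𝟙-yes (toℕ k ℕ.≟ suc (toℕ l₀)) k≡1+l₀) ⟩
    W k j + -1ℤ * W l₀ j
      ≡⟨ cong (λ x → W k j + x) (-1*i≡-i (W l₀ j)) ⟩
    W k j - W l₀ j
      ≡⟨ cong (λ p → W k j - 𝟙 (window? start end p)) (position-pred k≡1+l₀ j) ⟩
    W k j - 𝟙 (window? start end (suc y ℕ.% m))
      ≡⟨ cong (λ x → W k j - x) (W-wrap y (position<m k j)) ⟩
    𝟙 (window? start end y) - 𝟙 (window? start end (suc y))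
      ≡⟨ 𝟙-window-step y start≤end ⟩
    𝟙 (suc y ℕ.≟ end) - 𝟙 (suc y ℕ.≟ start)
      ≡⟨ cong₂ _-_ (𝟙-cong (suc y ℕ.≟ end) (y ℕ.≟ v ℕ.+ s) ℕ.suc-injective (cong suc))
                   (𝟙-cong (suc y ℕ.≟ start) (y ℕ.≟ v) ℕ.suc-injective (cong suc)) ⟩
    𝟙 (y ℕ.≟ v ℕ.+ s) - 𝟙 (y ℕ.≟ v) ∎
    where
    open ≡-Reasoning
    k = suc i
    l₀ = Fin.inject₁ i
    y = position k j
    k≡1+l₀ : toℕ k ≡ suc (toℕ l₀)
    k≡1+l₀ = cong suc (sym (Fin.toℕ-inject₁ i))
    others : ∀ l → l ≢ l₀ → previousRow k l * W l j ≡ 0ℤ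
    others l l≢l₀ = trans (cong (λ x → - x * W l j) (𝟙-no (toℕ k ℕ.≟ suc (toℕ l))
                            (λ k≡1+l → l≢l₀ (Fin.toℕ-injective
                                                 (ℕ.suc-injective (trans (sym k≡1+l) k≡1+l₀))))))
                          (*-zeroˡ (W l j))

  last : Fin m
  last = Fin.fromℕ m₁

  ≮m₁⇒last : ∀ {k : Fin m} → ¬ toℕ k < m₁ → k ≡ last
  ≮m₁⇒last {k} k≮m₁ = Fin.toℕ-injective
    (trans (ℕ.≤-antisym (s≤s⁻¹ (Fin.toℕ<n k)) (ℕ.≮⇒≥ k≮m₁)) (sym (Fin.toℕ-fromℕ m₁)))

  <m₁⇒≢last : ∀ {k : Fin m} → toℕ k < m₁ → k ≢ last
  <m₁⇒≢last {k} k<m₁ refl = ℕ.<-irrefl (Fin.toℕ-fromℕ m₁) k<m₁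

  select : Fin m → ℤ → ℤ → ℤ
  select k x y with toℕ k ℕ.<? m₁
  ... | yes _ = x
  ... | no  _ = y

  select-inner : ∀ k {x y} → toℕ k < m₁ → select k x y ≡ x
  select-inner k k<m₁ with toℕ k ℕ.<? m₁
  ... | yes _   = refl
  ... | no  k≮ = ⊥-elim (k≮ k<m₁)

  select-last : ∀ k {x y} → ¬ toℕ k < m₁ → select k x y ≡ y
  select-last k k≮m₁ with toℕ k ℕ.<? m₁
  ... | yes k< = ⊥-elim (k≮m₁ k<)
  ... | no  _  = refl

  select-≡ : ∀ {k x y z} → x ≡ z → y ≡ z → select k x y ≡ z
  select-≡ {k} x≡z y≡z with toℕ k ℕ.<? m₁
  ... | yes _ = x≡z
  ... | no  _ = y≡z

  ≢last⇒<m₁ : ∀ {k : Fin m} → k ≢ last → toℕ k < m₁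
  ≢last⇒<m₁ {k} k≢last = ℕ.≤∧≢⇒< (s≤s⁻¹ (Fin.toℕ<n k))
    (λ k≡m₁ → k≢last (Fin.toℕ-injective (trans k≡m₁ (sym (Fin.toℕ-fromℕ m₁)))))

  e : Fin m → Fin m → ℤ
  e c j = 𝟙 (j Fin.≟ c)

  e-diagonal : ∀ c → e c c ≡ 1ℤ
  e-diagonal c = 𝟙-yes (c Fin.≟ c) refl

  e-off : ∀ {c j} → j ≢ c → e c j ≡ 0ℤ
  e-off {c} {j} = 𝟙-no (j Fin.≟ c)

  module _ (coprime : Coprime m s) where

    open Orbit s coprime

    -- Row π k of D is e (σ k) − e (τ k): rows taken in the order s, 2s, …, m s (mod m)
    -- walk along a single cycle, as s generates ℤ/m.
    π : Fin m → Fin m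
    π k = orbit s (toℕ k)

    τ : ℕ → Fin m
    τ = orbit (s ℕ.+ v)

    σ : Fin m → Fin m
    σ k = τ (suc (toℕ k))

    π-injective : Injective _≡_ _≡_ π
    π-injective eq = Fin.toℕ-injective (orbit-injective (Fin.toℕ<n _) (Fin.toℕ<n _) eq)

    π-last : π last ≡ zero
    π-last = begin
      orbit s (toℕ last)        ≡⟨ cong (orbit s) (Fin.toℕ-fromℕ m₁) ⟩
      orbit s m₁                ≡⟨ cong (λ c → orbit c m₁) (ℕ.+-identityʳ s) ⟨
      orbit (s ℕ.+ 0) m₁        ≡⟨ orbit-suc 0 m₁ ⟨
      orbit 0 m                 ≡⟨ orbit-period 0 ⟩
      zero                      ∎
      where open ≡-Reasoning

    π-inner : ∀ {k} → toℕ k < m₁ → π k ≢ zero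
    π-inner k<m₁ πk≡0 = <m₁⇒≢last k<m₁ (π-injective (trans πk≡0 (sym π-last)))

    σ≡orbit : ∀ k → σ k ≡ orbit (s ℕ.+ (v ℕ.+ s)) (toℕ k)
    σ≡orbit k = trans (orbit-suc (s ℕ.+ v) (toℕ k)) (cong (λ c → orbit (s ℕ.+ c) (toℕ k)) (ℕ.+-comm s v))

    σ-injective : Injective _≡_ _≡_ σ
    σ-injective {k} {l} eq = Fin.toℕ-injective
      (orbit-injective (Fin.toℕ<n k) (Fin.toℕ<n l) (trans (sym (σ≡orbit k)) (trans eq (σ≡orbit l))))

    σ-last : σ last ≡ τ 0
    σ-last = trans (cong (λ x → τ (suc x)) (Fin.toℕ-fromℕ m₁)) (orbit-period (s ℕ.+ v))

    σ-inner : ∀ {k} → toℕ k < m₁ → σ k ≢ τ 0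
    σ-inner k<m₁ σk≡τ₀ = <m₁⇒≢last k<m₁ (σ-injective (trans σk≡τ₀ (sym σ-last)))

    P : Matrix m
    P k j = select k (e (σ k) j - e (τ (toℕ k)) j) (W zero j)

    D-nonzero : ∀ r → r ≢ zero → ∀ j → D r j ≡ 𝟙 (position r j ℕ.≟ v ℕ.+ s) - 𝟙 (position r j ℕ.≟ v)
    D-nonzero zero    r≢0 = ⊥-elim (r≢0 refl)
    D-nonzero (suc i) _   = D-suc i

    D∘π≡P : ∀ k j → D (π k) j ≡ P k j
    D∘π≡P k j = entry (toℕ k ℕ.<? m₁)
      where
      v+s<m : v ℕ.+ s < m
      v+s<m = s≤s fits
      v<m : v < m
      v<m = ℕ.≤-<-trans (ℕ.m≤m+n v s) v+s<m
      entry : Dec (toℕ k < m₁) → D (π k) j ≡ P k j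
      entry (yes k<m₁) = begin
        D (π k) j
          ≡⟨ D-nonzero (π k) (π-inner k<m₁) j ⟩
        𝟙 (position (π k) j ℕ.≟ v ℕ.+ s) - 𝟙 (position (π k) j ℕ.≟ v)
          ≡⟨ cong₂ _-_
               (𝟙-cong (position (π k) j ℕ.≟ v ℕ.+ s) (j Fin.≟ σ k)
                       (λ eq → trans (position-orbit⇒ s (toℕ k) j eq) (sym (σ≡orbit k)))
                       (λ eq → position-orbit⇐ s (toℕ k) j v+s<m (trans eq (σ≡orbit k))))
               (𝟙-cong (position (π k) j ℕ.≟ v) (j Fin.≟ τ (toℕ k))
                       (position-orbit⇒ s (toℕ k) j) (position-orbit⇐ s (toℕ k) j v<m)) ⟩
        e (σ k) j - e (τ (toℕ k)) j
          ≡⟨ select-inner k k<m₁ ⟨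
        P k j ∎
        where open ≡-Reasoning
      entry (no k≮m₁) = begin
        D (π k) j     ≡⟨ cong (λ r → D r j) (trans (cong π (≮m₁⇒last k≮m₁)) π-last) ⟩
        D zero j      ≡⟨ D-zero j ⟩
        W zero j      ≡⟨ select-last k k≮m₁ ⟨
        P k j         ∎
        where open ≡-Reasoning

    prefixSum : Fin m → Fin m → ℤ
    prefixSum k l = select k (𝟙 (toℕ l ℕ.<? toℕ k)) 0ℤ

    prefixSum-lower : StrictlyLower prefixSum
    prefixSum-lower {k} {l} k≤l =
      select-≡ (𝟙-no (toℕ l ℕ.<? toℕ k) (λ l<k → ℕ.<-irrefl refl (ℕ.<-≤-trans l<k k≤l))) refl

    Q : Matrix m
    Q k j = select k (e (σ k) j - e (τ 0) j) (W zero j)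

    -- along the cycle the differences telescope
    addRows-prefixSum : ∀ k j → addRows prefixSum P k j ≡ Q k j
    addRows-prefixSum k j = entry (toℕ k ℕ.<? m₁)
      where
      K = toℕ k
      g : ℕ → ℤ
      g x = e (τ x) j
      term : K < m₁ → ∀ l → prefixSum k l * P l j ≡ 𝟙 (toℕ l ℕ.<? K) * (g (suc (toℕ l)) - g (toℕ l))
      term K<m₁ l = trans (cong (_* P l j) (select-inner k K<m₁)) (case (toℕ l ℕ.<? K))
        where
        case : (d : Dec (toℕ l < K)) → 𝟙 d * P l j ≡ 𝟙 d * (g (suc (toℕ l)) - g (toℕ l))
        case (yes l<K) = cong (1ℤ *_) (select-inner l (ℕ.<-trans l<K K<m₁))
        case (no  _)   = trans (*-zeroˡ (P l j)) (sym (*-zeroˡ (g (suc (toℕ l)) - g (toℕ l))))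
      entry : Dec (K < m₁) → addRows prefixSum P k j ≡ Q k j
      entry (yes K<m₁) = begin
        P k j + sumFin {m} (λ l → prefixSum k l * P l j)
          ≡⟨ cong₂ _+_ (select-inner k K<m₁) (sumFin-cong (term K<m₁)) ⟩
        (g (suc K) - g K) + sumFin {m} (λ l → 𝟙 (toℕ l ℕ.<? K) * (g (suc (toℕ l)) - g (toℕ l)))
          ≡⟨ cong (λ x → (g (suc K) - g K) + x) (sumFin-telescope K g (ℕ.<⇒≤ (Fin.toℕ<n k))) ⟩
        (g (suc K) - g K) + (g K - g 0)
          ≡⟨ collapse (g 0) (g K) (g (suc K)) ⟩
        g (suc K) - g 0
          ≡⟨ select-inner k K<m₁ ⟨
        Q k j ∎
        where
        open ≡-Reasoning
        collapse : ∀ x y z → (z - y) + (y - x) ≡ z - x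
        collapse = solve-∀
      entry (no K≮m₁) = begin
        P k j + sumFin {m} (λ l → prefixSum k l * P l j)
          ≡⟨ cong (λ x → P k j + x) (sumFin-zero λ l →
               trans (cong (_* P l j) (select-last k {𝟙 (toℕ l ℕ.<? K)} {0ℤ} K≮m₁)) (*-zeroˡ (P l j))) ⟩
        P k j + 0ℤ
          ≡⟨ +-identityʳ (P k j) ⟩
        P k j
          ≡⟨ trans (select-last k K≮m₁) (sym (select-last k K≮m₁)) ⟩
        Q k j ∎
        where open ≡-Reasoning

    sumFin-W₀ : sumFin (W zero) ≡ + s
    sumFin-W₀ = begin
      sumFin (W zero)
        ≡⟨ sumFin-cong (λ j → cong (λ p → 𝟙 (window? start end p)) (position-zero j)) ⟩
      sumFin {m} (λ j → 𝟙 (window? start end (toℕ j)))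
        ≡⟨ sumFin-window start end start≤end end≤m ⟩
      + (v ℕ.+ s ℕ.∸ v)
        ≡⟨ cong +_ (ℕ.m+n∸m≡n v s) ⟩
      + s ∎
      where open ≡-Reasoning

    sumFin-W₀*e : ∀ j → sumFin (λ l → W zero l * e l j) ≡ W zero j
    sumFin-W₀*e j = trans
      (sumFin-single j (λ l → W zero l * e l j)
        (λ l l≢j → trans (cong (W zero l *_) (e-off (l≢j ∘ sym))) (*-zeroʳ (W zero l))))
      (trans (cong (W zero j *_) (e-diagonal j)) (*-identityʳ (W zero j)))

    clearLast : Fin m → Fin m → ℤ
    clearLast k l = select k 0ℤ (select l (- W zero (σ l)) 0ℤ)

    clearLast-lower : StrictlyLower clearLast
    clearLast-lower {k} {l} k≤l = case (toℕ k ℕ.<? m₁)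
      where
      case : Dec (toℕ k < m₁) → clearLast k l ≡ 0ℤ
      case (yes k<m₁) = select-inner k k<m₁
      case (no  k≮m₁) = trans (select-last k k≮m₁) (select-last l (λ l<m₁ → k≮m₁ (ℕ.≤-<-trans k≤l l<m₁)))

    R : Matrix m
    R k j = select k (e (σ k) j - e (τ 0) j) (+ s * e (τ 0) j)

    -- σ is a bijection hitting τ 0 only on the last row, so the last row W₀ minus
    -- Σ_l W₀ (σ l) · (e (σ l) − e (τ 0)) is (Σ_j W₀ j) · e (τ 0).
    addRows-clearLast : ∀ k j → addRows clearLast Q k j ≡ R k j
    addRows-clearLast k j = entry (toℕ k ℕ.<? m₁)
      where
      w = W zero
      entry : Dec (toℕ k < m₁) → addRows clearLast Q k j ≡ R k j
      entry (yes k<m₁) = begin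
        Q k j + sumFin {m} (λ l → clearLast k l * Q l j)
          ≡⟨ cong (λ x → Q k j + x) (sumFin-zero λ l →
               cong (_* Q l j) (select-inner k {0ℤ} {select l (- w (σ l)) 0ℤ} k<m₁)) ⟩
        Q k j + 0ℤ
          ≡⟨ +-identityʳ (Q k j) ⟩
        Q k j
          ≡⟨ trans (select-inner k k<m₁) (sym (select-inner k k<m₁)) ⟩
        R k j ∎
        where open ≡-Reasoning
      entry (no k≮m₁) = begin
        Q k j + sumFin {m} (λ l → clearLast k l * Q l j)
          ≡⟨ cong₂ _+_ (select-last k k≮m₁)
                       (sumFin-cong λ l → trans (term l) (expand (w (σ l)) (e (σ l) j) (e (τ 0) j))) ⟩
        w j + sumFin (λ l → -1ℤ * (w (σ l) * e (σ l) j) + e (τ 0) j * w (σ l))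
          ≡⟨ cong (λ x → w j + x) (sumFin-linear -1ℤ (e (τ 0) j) (λ l → w (σ l) * e (σ l) j) (w ∘ σ)) ⟩
        w j + (-1ℤ * sumFin (λ l → w (σ l) * e (σ l) j) + e (τ 0) j * sumFin (w ∘ σ))
          ≡⟨ cong₂ (λ x y → w j + (-1ℤ * x + e (τ 0) j * y))
               (trans (sumFin-reindex σ-injective (λ l → w l * e l j)) (sumFin-W₀*e j))
               (trans (sumFin-reindex σ-injective w) sumFin-W₀) ⟩
        w j + (-1ℤ * w j + e (τ 0) j * + s)
          ≡⟨ cancel (w j) (e (τ 0) j) (+ s) ⟩
        + s * e (τ 0) j
          ≡⟨ select-last k k≮m₁ ⟨
        R k j ∎
        where
        open ≡-Reasoning
        cancel : ∀ a x y → a + (-1ℤ * a + x * y) ≡ y * x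
        cancel = solve-∀
        expand : ∀ a x y → - a * (x - y) ≡ -1ℤ * (a * x) + y * a
        expand = solve-∀
        term : ∀ l → clearLast k l * Q l j ≡ - w (σ l) * (e (σ l) j - e (τ 0) j)
        term l = trans (cong (_* Q l j) (select-last k k≮m₁)) (case (toℕ l ℕ.<? m₁))
          where
          case : Dec (toℕ l < m₁) → select l (- w (σ l)) 0ℤ * Q l j ≡ - w (σ l) * (e (σ l) j - e (τ 0) j)
          case (yes l<m₁) = cong₂ _*_ (select-inner l l<m₁) (select-inner l l<m₁)
          case (no  l≮m₁) = begin
            select l (- w (σ l)) 0ℤ * Q l j         ≡⟨ cong (_* Q l j) (select-last l l≮m₁) ⟩
            0ℤ                                      ≡⟨ *-zeroʳ (- w (σ l)) ⟨
            - w (σ l) * 0ℤ                          ≡⟨ cong (- w (σ l) *_) e₍σl₎-e₍τ₀₎≡0 ⟨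
            - w (σ l) * (e (σ l) j - e (τ 0) j)     ∎
            where
            e₍σl₎-e₍τ₀₎≡0 : e (σ l) j - e (τ 0) j ≡ 0ℤ
            e₍σl₎-e₍τ₀₎≡0 = trans (cong (λ c → e c j - e (τ 0) j) (trans (cong σ (≮m₁⇒last l≮m₁)) σ-last))
                                  (+-inverseʳ (e (τ 0) j))

    R-below : ∀ {i i′} → toℕ i < toℕ i′ → R i′ (σ i) ≡ 0ℤ
    R-below {i} {i′} i<i′ = case (toℕ i′ ℕ.<? m₁)
      where
      i<m₁ : toℕ i < m₁
      i<m₁ = ℕ.<-≤-trans i<i′ (s≤s⁻¹ (Fin.toℕ<n i′))
      σi≢τ₀ = σ-inner i<m₁
      case : Dec (toℕ i′ < m₁) → R i′ (σ i) ≡ 0ℤ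
      case (yes i′<m₁) = trans (select-inner i′ i′<m₁)
        (cong₂ _-_ (e-off (λ σi≡σi′ → ℕ.<-irrefl (cong toℕ (σ-injective σi≡σi′)) i<i′)) (e-off σi≢τ₀))
      case (no  i′≮m₁) = trans (select-last i′ i′≮m₁) (trans (cong (+ s *_) (e-off σi≢τ₀)) (*-zeroʳ (+ s)))

    R-diagonal : product (λ i → R i (σ i)) ≡ + s
    R-diagonal = begin
      product (λ i → R i (σ i))
        ≡⟨ product-remove {i = last} (λ i → R i (σ i)) ⟩
      R last (σ last) * product (λ i → R (punchIn last i) (σ (punchIn last i)))
        ≡⟨ cong₂ _*_ lastEntry (trans (product-cong innerEntry) (product-replicate-one m₁)) ⟩
      + s * 1ℤ
        ≡⟨ *-identityʳ (+ s) ⟩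
      + s ∎
      where
      open ≡-Reasoning
      lastEntry : R last (σ last) ≡ + s
      lastEntry = begin
        R last (σ last)          ≡⟨ select-last last (λ m₁<m₁ → ℕ.<-irrefl (Fin.toℕ-fromℕ m₁) m₁<m₁) ⟩
        + s * e (τ 0) (σ last)   ≡⟨ cong (λ c → + s * e (τ 0) c) σ-last ⟩
        + s * e (τ 0) (τ 0)      ≡⟨ cong (+ s *_) (e-diagonal (τ 0)) ⟩
        + s * 1ℤ                 ≡⟨ *-identityʳ (+ s) ⟩
        + s                      ∎
      innerEntry : ∀ i → R (punchIn last i) (σ (punchIn last i)) ≡ 1ℤ
      innerEntry i = trans (select-inner p p<m₁) (cong₂ _-_ (e-diagonal (σ p)) (e-off (σ-inner p<m₁)))
        where
        p = punchIn last i
        p<m₁ = ≢last⇒<m₁ (Fin.punchInᵢ≢i last i)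

    ∣det∣-W : ∣ det W ∣ ≡ s
    ∣det∣-W = begin
      ∣ det W ∣                        ≡⟨ cong ∣_∣ (det-addRows previousRow previousRow-lower W) ⟨
      ∣ det D ∣                        ≡⟨ ∣det∣-permuteRows π-injective D ⟨
      ∣ det (D ∘ π) ∣                  ≡⟨ cong ∣_∣ (det-cong D∘π≡P) ⟩
      ∣ det P ∣                        ≡⟨ cong ∣_∣ (det-addRows prefixSum prefixSum-lower P) ⟨
      ∣ det (addRows prefixSum P) ∣    ≡⟨ cong ∣_∣ (det-cong addRows-prefixSum) ⟩
      ∣ det Q ∣                        ≡⟨ cong ∣_∣ (det-addRows clearLast clearLast-lower Q) ⟨
      ∣ det (addRows clearLast Q) ∣    ≡⟨ cong ∣_∣ (det-cong addRows-clearLast) ⟩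
      ∣ det R ∣                        ≡⟨ ∣det∣-triangular R σ-injective R-below ⟩
      ∣ product (λ i → R i (σ i)) ∣    ≡⟨ cong ∣_∣ R-diagonal ⟩
      s                                ∎
      where open ≡-Reasoning

module Circulant (h′ r : ℕ) (r<h : r < suc h′) where

  open import Data.Nat using (_+_; _*_; _∸_; _%_; ∣_-_∣; ⌊_/2⌋)
  open import Data.Nat.DivMod using ([m+n]%n≡m%n; m<n⇒m%n≡m)
  open import Data.Nat.Tactic.RingSolver using (solve-∀)
  open import Data.List.Relation.Unary.Any using (Any)
  open import Data.List.Relation.Unary.Any.Properties using (map⁺; map⁻)
  open import Data.List.Membership.Propositional using (find; lose)
  open import Data.List.Membership.Propositional.Properties using (∈-upTo⁺; ∈-upTo⁻)
  open import Data.Sum using (_⊎_; inj₁; inj₂)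
  open import Function.Bundles using (_⇔_; mk⇔; Equivalence)
  import Function.Properties.Equivalence as ⇔
  open import Function using (id)
  open Indicator

  -- m₁ is chosen so that suc m₁ and m are the same number by computation
  h m₁ m : ℕ
  h  = suc h′
  m₁ = h′ + h
  m  = h + h

  open Cyclic m₁ using (position; position≡⇐)

  r≤h : r ≤ h
  r≤h = ℕ.<⇒≤ r<h

  ⌊m/2⌋≡h : ⌊ m /2⌋ ≡ h
  ⌊m/2⌋≡h = sym (ℕ.n≡⌊n+n/2⌋ h)

  Near : ℕ → Set
  Near δ = h ∸ r ≤ δ × δ ≤ h + r

  h∸k-near : ∀ {k} → k ≤ r → Near (h ∸ k)
  h∸k-near {k} k≤r = ℕ.∸-monoʳ-≤ h k≤r , ℕ.≤-trans (ℕ.m∸n≤m h k) (ℕ.m≤m+n h r)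

  near-complement : ∀ {δ} → Near δ → Near (m ∸ δ)
  near-complement {δ} (h∸r≤δ , δ≤h+r) =
    subst (_≤ m ∸ δ) (ℕ.[m+n]∸[m+o]≡n∸o h h r) (ℕ.∸-monoʳ-≤ m δ≤h+r) ,
    subst (m ∸ δ ≤_) m∸[h∸r]≡h+r (ℕ.∸-monoʳ-≤ m h∸r≤δ)
    where
    m∸[h∸r]≡h+r : m ∸ (h ∸ r) ≡ h + r
    m∸[h∸r]≡h+r = trans (ℕ.+-∸-assoc h (ℕ.m∸n≤m h r)) (cong (h +_) (ℕ.m∸[m∸n]≡n r≤h))

  near⇒≤m : ∀ {δ} → Near δ → δ ≤ m
  near⇒≤m (_ , δ≤h+r) = ℕ.≤-trans δ≤h+r (ℕ.+-monoʳ-≤ h r≤h)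

  near⇔complement : ∀ {δ} → δ ≤ m → Near δ ⇔ Near (m ∸ δ)
  near⇔complement {δ} δ≤m = mk⇔ near-complement
    (λ near → subst Near (ℕ.m∸[m∸n]≡n δ≤m) (near-complement near))

  ≡⇒⇔ : ∀ {x y} → x ≡ y → Near x ⇔ Near y
  ≡⇒⇔ refl = mk⇔ id id

  near-below : ∀ {δ} → Near δ → δ ≤ h → Σ ℕ λ k → k < suc r × δ ≡ h ∸ k
  near-below {δ} (h∸r≤δ , _) δ≤h =
    h ∸ δ , s≤s (subst (h ∸ δ ≤_) (ℕ.m∸[m∸n]≡n r≤h) (ℕ.∸-monoʳ-≤ h h∸r≤δ)) , sym (ℕ.m∸[m∸n]≡n δ≤h)

  circAdj⇔near : ∀ i j → CircAdj m (connSet m r) i j ⇔ Near ∣ toℕ i - toℕ j ∣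
  circAdj⇔near i j = mk⇔ to from
    where
    δ = ∣ toℕ i - toℕ j ∣
    ⌊m/2⌋∸ : ∀ k → ⌊ m /2⌋ ∸ k ≡ h ∸ k
    ⌊m/2⌋∸ k = cong (_∸ k) ⌊m/2⌋≡h
    to : CircAdj m (connSet m r) i j → Near δ
    to (_ , adjacent) with find (map⁻ adjacent)
    ... | k , k∈ , inj₁ δ≡ = subst Near (sym (trans δ≡ (⌊m/2⌋∸ k))) (h∸k-near (s≤s⁻¹ (∈-upTo⁻ k∈)))
    ... | k , k∈ , inj₂ δ≡ = subst Near (sym (trans δ≡ (cong (m ∸_) (⌊m/2⌋∸ k))))
                                   (near-complement (h∸k-near (s≤s⁻¹ (∈-upTo⁻ k∈))))
    at : ∀ {k} → k < suc r → (δ ≡ ⌊ m /2⌋ ∸ k) ⊎ (δ ≡ m ∸ (⌊ m /2⌋ ∸ k)) →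
         Any (λ x → (δ ≡ x) ⊎ (δ ≡ m ∸ x)) (connSet m r)
    at k<1+r = map⁺ ∘ lose (∈-upTo⁺ k<1+r)
    from : Near δ → CircAdj m (connSet m r) i j
    from near@(h∸r≤δ , _) = i≢j , adjacent (δ ℕ.≤? h)
      where
      i≢j : i ≢ j
      i≢j i≡j = ℕ.<-irrefl refl (ℕ.<-≤-trans (ℕ.m<n⇒0<n∸m r<h)
                  (subst (h ∸ r ≤_) (ℕ.m≡n⇒∣m-n∣≡0 (cong toℕ i≡j)) h∸r≤δ))
      adjacent : Dec (δ ≤ h) → Any (λ x → (δ ≡ x) ⊎ (δ ≡ m ∸ x)) (connSet m r)
      adjacent (yes δ≤h) with near-below near δ≤h
      ... | k , k<1+r , δ≡h∸k = at k<1+r (inj₁ (trans δ≡h∸k (sym (⌊m/2⌋∸ k))))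
      adjacent (no  δ≰h) with near-below (near-complement near) m∸δ≤h
        where
        m∸δ≤h : m ∸ δ ≤ h
        m∸δ≤h = subst (m ∸ δ ≤_) (ℕ.m+n∸m≡n h h) (ℕ.∸-monoʳ-≤ m (ℕ.<⇒≤ (ℕ.≰⇒> δ≰h)))
      ... | k , k<1+r , m∸δ≡h∸k = at k<1+r (inj₂ (trans (sym (ℕ.m∸[m∸n]≡n (near⇒≤m near)))
                                                        (cong (m ∸_) (trans m∸δ≡h∸k (sym (⌊m/2⌋∸ k))))))

  near-position : ∀ i j → Near (position i j) ⇔ Near ∣ toℕ i - toℕ j ∣
  near-position i j with toℕ i ℕ.≤? toℕ j
  ... | yes i≤j = ≡⇒⇔ (trans position≡j∸i (sym (ℕ.m≤n⇒∣m-n∣≡n∸m i≤j)))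
    where
    position≡j∸i : position i j ≡ toℕ j ∸ toℕ i
    position≡j∸i = position≡⇐ i j (ℕ.≤-<-trans (ℕ.m∸n≤m (toℕ j) (toℕ i)) (Fin.toℕ<n j))
      (sym (trans (cong (_% m) (ℕ.m+[n∸m]≡n i≤j)) (m<n⇒m%n≡m (Fin.toℕ<n j))))
  ... | no  i≰j = ⇔.trans (≡⇒⇔ position≡m∸d) (⇔.sym (near⇔complement δ≤m))
    where
    j<i = ℕ.≰⇒> i≰j
    d = toℕ i ∸ toℕ j
    d≤m : d ≤ m
    d≤m = ℕ.≤-trans (ℕ.m∸n≤m (toℕ i) (toℕ j)) (ℕ.<⇒≤ (Fin.toℕ<n i))
    δ≡d : ∣ toℕ i - toℕ j ∣ ≡ d
    δ≡d = ℕ.m≤n⇒∣n-m∣≡n∸m (ℕ.<⇒≤ j<i)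
    δ≤m : ∣ toℕ i - toℕ j ∣ ≤ m
    δ≤m = subst (_≤ m) (sym δ≡d) d≤m
    i+[m∸d]≡j+m : toℕ i + (m ∸ d) ≡ toℕ j + m
    i+[m∸d]≡j+m = begin
      toℕ i + (m ∸ d)            ≡⟨ cong (_+ (m ∸ d)) (ℕ.m∸n+n≡m (ℕ.<⇒≤ j<i)) ⟨
      d + toℕ j + (m ∸ d)        ≡⟨ regroup d (toℕ j) (m ∸ d) ⟩
      toℕ j + (d + (m ∸ d))      ≡⟨ cong (toℕ j +_) (ℕ.m+[n∸m]≡n d≤m) ⟩
      toℕ j + m                  ∎
      where
      open ≡-Reasoning
      regroup : ∀ a b c → a + b + c ≡ b + (a + c)
      regroup = solve-∀
    position≡m∸d : position i j ≡ m ∸ ∣ toℕ i - toℕ j ∣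
    position≡m∸d = trans
      (position≡⇐ i j (ℕ.∸-monoʳ-< (ℕ.m<n⇒0<n∸m j<i) d≤m)
        (sym (trans (cong (_% m) i+[m∸d]≡j+m) (trans ([m+n]%n≡m%n (toℕ j) m) (m<n⇒m%n≡m (Fin.toℕ<n j))))))
      (cong (m ∸_) (sym δ≡d))

  v s : ℕ
  v = h ∸ suc r
  s = 2 * r + 1

  1+v≡h∸r : suc v ≡ h ∸ r
  1+v≡h∸r = sym (ℕ.+-∸-assoc 1 r<h)

  v+s≡h+r : v + s ≡ h + r
  v+s≡h+r = begin
    v + (2 * r + 1)        ≡⟨ cong (v +_) (regroup r) ⟩
    v + (suc r + r)        ≡⟨ ℕ.+-assoc v (suc r) r ⟨
    v + suc r + r          ≡⟨ cong (_+ r) (ℕ.m∸n+n≡m r<h) ⟩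
    h + r                  ∎
    where
    open ≡-Reasoning
    regroup : ∀ r → 2 * r + 1 ≡ suc r + r
    regroup = solve-∀

  fits : v + s ≤ m₁
  fits = subst₂ _≤_ (sym v+s≡h+r) (ℕ.+-comm h h′) (ℕ.+-monoʳ-≤ h (s≤s⁻¹ r<h))

  open WindowCirculant m₁ v s fits using (W; start; end; ∣det∣-W)

  near⇔window : ∀ {p} → Near p ⇔ Window start end p
  near⇔window {p} = mk⇔
    (λ (h∸r≤p , p≤h+r) → subst (_≤ p) (sym 1+v≡h∸r) h∸r≤p , s≤s (subst (p ≤_) (sym v+s≡h+r) p≤h+r))
    (λ (start≤p , p<end) → subst (_≤ p) 1+v≡h∸r start≤p , subst (p ≤_) v+s≡h+r (s≤s⁻¹ p<end))

  adjacency≡𝟙 : ∀ i j → adjacency m (connSet m r) i j ≡ 𝟙 (circAdj? m (connSet m r) i j)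
  adjacency≡𝟙 i j with circAdj? m (connSet m r) i j
  ... | yes _ = refl
  ... | no  _ = refl

  adjacency≡W : ∀ i j → adjacency m (connSet m r) i j ≡ W i j
  adjacency≡W i j = trans (adjacency≡𝟙 i j)
    (𝟙-cong (circAdj? m (connSet m r) i j) (window? start end (position i j))
            (Equivalence.to circAdj⇔window) (Equivalence.from circAdj⇔window))
    where
    circAdj⇔window = ⇔.trans (circAdj⇔near i j) (⇔.trans (⇔.sym (near-position i j)) near⇔window)

  ∣det∣-adjacency : Coprime m s → ∣ det (adjacency m (connSet m r)) ∣ ≡ s
  ∣det∣-adjacency coprime = trans (cong ∣_∣ (Determinant.det-cong adjacency≡W)) (∣det∣-W coprime)

open import Data.Nat using (_+_; _*_; _^_; _∸_; ⌊_/2⌋)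
open import Data.Nat.Divisibility using (∣1⇒≡1; ∣m+n∣m⇒∣n; ∣m⇒∣m*n)
open import Data.Nat.Coprimality using (coprime-factors)

∣det∣-circulant : ∀ h r → r < h → Coprime (h + h) (2 * r + 1) →
  ∣ det (adjacency (h + h) (connSet (h + h) r)) ∣ ≡ 2 * r + 1
∣det∣-circulant (suc h′) r r<h = Circulant.∣det∣-adjacency h′ r r<h

coprime-2-odd : ∀ r → Coprime 2 (2 * r + 1)
coprime-2-odd r (d∣2 , d∣2r+1) = ∣1⇒≡1 (∣m+n∣m⇒∣n d∣2r+1 (∣m⇒∣m*n r d∣2))

coprime-2^-odd : ∀ n r → Coprime (2 ^ n) (2 * r + 1)
coprime-2^-odd zero    r (d∣1 , _)            = ∣1⇒≡1 d∣1
coprime-2^-odd (suc n) r (d∣2^[1+n] , d∣odd) =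
  coprime-2^-odd n r (coprime-factors (coprime-2-odd r) (d∣2^[1+n] , ∣m⇒∣m*n (2 ^ n) d∣odd) , d∣odd)

lemma1 : (n r : ℕ) → 2 < n → 1 ≤ r → r ≤ ⌊ 2 ^ n /2⌋ ∸ 1 →
    ∣ det (adjacency (2 ^ n) (connSet (2 ^ n) r)) ∣ ≡ 2 * r + 1
lemma1 (suc n) r _ _ r≤h∸1 =
  subst (λ M → ∣ det (adjacency M (connSet M r)) ∣ ≡ 2 * r + 1) (sym 2^[1+n]≡h+h)
        (∣det∣-circulant h r r<h coprime)
  where
  h = 2 ^ n
  2^[1+n]≡h+h : 2 ^ suc n ≡ h + h
  2^[1+n]≡h+h = cong (h +_) (ℕ.+-identityʳ h)
  coprime : Coprime (h + h) (2 * r + 1)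
  coprime = subst (λ M → Coprime M (2 * r + 1)) 2^[1+n]≡h+h (coprime-2^-odd (suc n) r)
  ⌊2^[1+n]/2⌋≡h : ⌊ 2 ^ suc n /2⌋ ≡ h
  ⌊2^[1+n]/2⌋≡h = trans (cong ⌊_/2⌋ 2^[1+n]≡h+h) (sym (ℕ.n≡⌊n+n/2⌋ h))
  r<h : r < h
  r<h = ℕ.≤-<-trans (subst (λ x → r ≤ x ∸ 1) ⌊2^[1+n]/2⌋≡h r≤h∸1) (ℕ.∸-monoʳ-< (s≤s z≤n) (ℕ.m^n>0 2 n))
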